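{- Let $G:\{0,1\}^n\to\{0,1\}^N$ be a demi-bits generator, let $\mathcal{H}=\{h:\{0,1\}^N\to\{0,1\}^m\}$ be an (efficiently computable, polynomial-key-length) family of pairwise independent hash functions, and let $\mathcal{A}$ be a nondeterministic polynomial-time algorithm. If $N>10m$ and $m>n$, then (for all sufficiently large $n$) there exists $h\in\mathcal{H}$ such that $\mathcal{A}$ fails to solve the range avoidance problem on the input circuit $h\circ G:\{0,1\}^n\to\{0,1\}^m$.
   Context: Range avoidance: given a circuit $C:\{0,1\}^n\to\{0,1\}^m$ with $m>n$, output $y\notin\mathrm{Range}(C)$. A nondeterministic algorithm $\mathcal{A}$ solves range avoidance on input $C$ if $\mathcal{A}(C)$ has at least one accepting path and every accepting path outputs a string outside $\mathrm{Range}(C)$; otherwise it fails on $C$. Demi-bits generator: a family $G_n:\{0,1\}^n\to\{0,1\}^{N(n)}$, $N>n$, computable by polynomial-size circuits, such that for every family of polynomial-size nondeterministic circuits $D$ and all sufficiently large $n$, it is not the case that both $\Pr_{y\sim\{0,1\}^N}[D(y)=1]\ge 1/3$ and $D(G_n(x))=0$ for all $x\in\{0,1\}^n$. A family $\mathcal{H}$ of functions $\{0,1\}^N\to\{0,1\}^m$ is pairwise independent if for all distinct $y,y'$ the pair $(h(y),h(y'))$ is uniform over $(\{0,1\}^m)^2$ for $h$ uniform in $\mathcal{H}$. -}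

module Defs where

open import Data.Nat using (ℕ; zero; suc; _+_; _*_; _^_; _≤_; _<_)
open import Data.Bool using (Bool; true; false; _∧_; _∨_; not; if_then_else_)
open import Data.Fin using (Fin; zero; suc; toℕ)
import Data.Fin as F
open import Data.Vec as V using (Vec; _∷_; lookup; tabulate)
open import Data.List as L using (List; _∷_)
open import Data.Maybe using (Maybe; just; nothing)
open import Data.Product using (Σ; _×_; _,_; proj₁; proj₂)
open import Function using (id; _∘_)
open import Relation.Nullary using (¬_; does)
open import Relation.Binary.PropositionalEquality using (_≡_)
import Data.Vec.Properties as VP
import Data.Bool.Properties as BP
open import Data.Bool.ListAction using (any)

-- Wires are numbered de Bruijn style: a circuit with n inputs and
-- w wires in total has wire values in Vec Bool w; each new gate is
-- pushed at position 0.  Initially the wires are exactly the inputs.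

data Gate (w : ℕ) : Set where
  AND OR : Fin w → Fin w → Gate w
  NOT    : Fin w → Gate w
  CONST  : Bool → Gate w

data Gates (n : ℕ) : ℕ → Set where
  input : Gates n n
  _▷_   : ∀ {w} → Gates n w → Gate w → Gates n (suc w)

record Circuit (n m : ℕ) : Set where
  constructor circuit
  field
    wires : ℕ
    gates : Gates n wires
    outs  : Vec (Fin wires) m
open Circuit public

size : ∀ {n m} → Circuit n m → ℕ
size = wires

evalGate : ∀ {w} → Gate w → Vec Bool w → Bool
evalGate (AND i j) v = lookup v i ∧ lookup v j
evalGate (OR i j)  v = lookup v i ∨ lookup v j
evalGate (NOT i)   v = not (lookup v i)
evalGate (CONST b) v = b

evalGates : ∀ {n w} → Gates n w → Vec Bool n → Vec Bool w
evalGates input    x = x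
evalGates (gs ▷ g) x = evalGate g (evalGates gs x) ∷ evalGates gs x

eval : ∀ {n m} → Circuit n m → Vec Bool n → Vec Bool m
eval C x = V.map (lookup (evalGates (gates C) x)) (outs C)

InRange : ∀ {n m} → Circuit n m → List Bool → Set
InRange {n} C y = Σ (Vec Bool n) λ x → V.toList (eval C x) ≡ y

mapGate : ∀ {w w'} → (Fin w → Fin w') → Gate w → Gate w'
mapGate σ (AND i j) = AND (σ i) (σ j)
mapGate σ (OR i j)  = OR (σ i) (σ j)
mapGate σ (NOT i)   = NOT (σ i)
mapGate σ (CONST b) = CONST b

extRen : ∀ {a b} → (Fin a → Fin b) → Fin (suc a) → Fin (suc b)
extRen σ zero    = zero
extRen σ (suc i) = suc (σ i)

-- append the gates of a second circuit (with k inputs) on top of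
-- gates g1, feeding its inputs from the wires ρ
graft : ∀ {n k w1 w2} → Gates n w1 → (Fin k → Fin w1) → Gates k w2 →
        Σ ℕ λ w → Gates n w × (Fin w2 → Fin w)
graft {w1 = w1} g1 ρ input = w1 , g1 , ρ
graft g1 ρ (gs ▷ g) =
  let r = graft g1 ρ gs in
  suc (proj₁ r) , (proj₁ (proj₂ r) ▷ mapGate (proj₂ (proj₂ r)) g) , extRen (proj₂ (proj₂ r))

compose : ∀ {n k m} → Circuit k m → Circuit n k → Circuit n m
compose C2 C1 =
  let r = graft (gates C1) (lookup (outs C1)) (gates C2) in
  circuit (proj₁ r) (proj₁ (proj₂ r)) (V.map (proj₂ (proj₂ r)) (outs C2))

consts : ∀ {N l} → Vec Bool l → Gates N (l + N)
consts V.[]     = input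
consts (b ∷ bs) = consts bs ▷ CONST b

prependKey : ∀ {l N} → Vec Bool l → Circuit N (l + N)
prependKey key = circuit _ (consts key) (tabulate id)

-- the circuit computing x ↦ h_key (G x), where h_key y = H (key ++ y)
hashAfter : ∀ {n l N m} → Circuit (l + N) m → Vec Bool l → Circuit n N → Circuit n m
hashAfter H key G = compose H (compose (prependKey key) G)

unary : ℕ → List Bool
unary k = L.replicate k true L.++ (false ∷ L.[])

encFin : ∀ {w} → Fin w → List Bool
encFin i = unary (toℕ i)

encGate : ∀ {w} → Gate w → List Bool
encGate (AND i j) = false ∷ false ∷ encFin i L.++ encFin j
encGate (OR i j)  = false ∷ true ∷ encFin i L.++ encFin j
encGate (NOT i)   = true ∷ false ∷ encFin i
encGate (CONST b) = true ∷ true ∷ b ∷ L.[]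

encGates : ∀ {n w} → Gates n w → List Bool
encGates input    = L.[]
encGates (gs ▷ g) = encGates gs L.++ encGate g

encode : ∀ {n m} → Circuit n m → List Bool
encode {n} {m} C =
  unary n L.++ unary m L.++ unary (wires C) L.++ encGates (gates C)
  L.++ L.concat (V.toList (V.map encFin (outs C)))

allBits : ∀ n → List (Vec Bool n)
allBits zero    = V.[] ∷ L.[]
allBits (suc n) = L.map (true ∷_) (allBits n) L.++ L.map (false ∷_) (allBits n)

count : ∀ {A : Set} → (A → Bool) → List A → ℕ
count p L.[]     = 0
count p (x ∷ xs) = (if p x then 1 else 0) + count p xs

_==v_ : ∀ {n} → Vec Bool n → Vec Bool n → Bool
u ==v v = does (VP.≡-dec BP._≟_ u v)

-- Nondeterministic circuits: D : Circuit (N + k) 1, with k witness bits;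
-- D(y) = 1 iff there is a witness w with D(y ++ w) = 1.

accepts : ∀ {N k} → Circuit (N + k) 1 → Vec Bool N → Bool
accepts {k = k} D y = any (λ w → V.head (eval D (y V.++ w))) (allBits k)

PolyBounded : (ℕ → ℕ) → Set
PolyBounded f = Σ ℕ λ c → ∀ n → f n ≤ n ^ c + c

Eventually : (ℕ → Set) → Set
Eventually P = Σ ℕ λ n₀ → ∀ n → n₀ ≤ n → P n

IsDemiBitsGenerator : (N : ℕ → ℕ) → ((n : ℕ) → Circuit n (N n)) → Set
IsDemiBitsGenerator N G =
  (∀ n → n < N n) ×
  PolyBounded (λ n → size (G n)) ×
  (∀ (k : ℕ → ℕ) (D : (n : ℕ) → Circuit (N n + k n) 1) →
     PolyBounded (λ n → size (D n)) →
     Eventually λ n →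
       ¬ ( (2 ^ N n ≤ 3 * count (accepts (D n)) (allBits (N n)))
         × (∀ (x : Vec Bool n) → accepts (D n) (eval (G n) x) ≡ false)))

-- Efficiently computable (polynomial-size circuits), polynomial key length,
-- pairwise independent hash family: h_key(y) = H n (key ++ y).
IsPairwiseIndependentFamily : (ℓ N m : ℕ → ℕ) →
  ((n : ℕ) → Circuit (ℓ n + N n) (m n)) → Set
IsPairwiseIndependentFamily ℓ N m H =
  PolyBounded ℓ ×
  PolyBounded (λ n → size (H n)) ×
  (∀ n (y y' : Vec Bool (N n)) → ¬ (y ≡ y') →
     ∀ (a b : Vec Bool (m n)) →
       count (λ key → (eval (H n) (key V.++ y) ==v a) ∧ (eval (H n) (key V.++ y') ==v b))
             (allBits (ℓ n)) * 2 ^ (m n + m n)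
       ≡ 2 ^ ℓ n)

-- Nondeterministic Turing machines (single two-way infinite tape,
-- symbols {0,1,blank}; one binary nondeterministic choice per step)

data Move : Set where
  moveL moveR stay : Move

Sym : Set
Sym = Maybe Bool

record NTM : Set where
  field
    states : ℕ
    start accept reject : Fin states
    δ : Fin states → Sym → Bool → Fin states × Sym × Move

record Tape : Set where
  constructor tape
  field
    lft : List Sym   -- cells to the left, nearest first
    hd  : Sym
    rgt : List Sym   -- cells to the right, nearest first

move : Move → Tape → Tape
move moveL (tape L.[] h r)       = tape L.[] nothing (h ∷ r)
move moveL (tape (l ∷ ls) h r)   = tape ls l (h ∷ r)
move moveR (tape l h L.[])       = tape (h ∷ l) nothing L.[]
move moveR (tape l h (r ∷ rs))   = tape (h ∷ l) r rs
move stay  t                     = t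

Config : NTM → Set
Config M = Fin (NTM.states M) × Tape

halted : (M : NTM) → Fin (NTM.states M) → Bool
halted M q = does (q F.≟ NTM.accept M) ∨ does (q F.≟ NTM.reject M)

step : (M : NTM) → Bool → Config M → Config M
step M b (q , t) =
  if halted M q then (q , t)
  else (let r = NTM.δ M q (Tape.hd t) b in
        proj₁ r , move (proj₂ (proj₂ r)) (record t { hd = proj₁ (proj₂ r) }))

run : (M : NTM) → ∀ {T} → Vec Bool T → Config M → Config M
run M V.[]       c = c
run M (b ∷ bs)   c = run M bs (step M b c)

initTape : List Bool → Tape
initTape L.[]     = tape L.[] nothing L.[]
initTape (b ∷ bs) = tape L.[] (just b) (L.map just bs)

takeBits : List Sym → List Bool
takeBits L.[]             = L.[]
takeBits (nothing ∷ _)    = L.[]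
takeBits (just b ∷ s)     = b ∷ takeBits s

readOut : Tape → List Bool
readOut (tape _ h r) = takeBits (h ∷ r)

-- A nondeterministic polynomial-time algorithm: an NTM clocked at
-- time |x|^c + c (paths that have not accepted by then reject).
record NPAlgorithm : Set where
  field
    machine  : NTM
    exponent : ℕ

timeBound : NPAlgorithm → ℕ → ℕ
timeBound A len = len ^ NPAlgorithm.exponent A + NPAlgorithm.exponent A

finalConfig : (A : NPAlgorithm) (x : List Bool) →
  Vec Bool (timeBound A (L.length x)) → Config (NPAlgorithm.machine A)
finalConfig A x p = run (NPAlgorithm.machine A) p (NTM.start (NPAlgorithm.machine A) , initTape x)

AcceptingPath : (A : NPAlgorithm) (x : List Bool) → Vec Bool (timeBound A (L.length x)) → Set
AcceptingPath A x p = proj₁ (finalConfig A x p) ≡ NTM.accept (NPAlgorithm.machine A)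

pathOutput : (A : NPAlgorithm) (x : List Bool) → Vec Bool (timeBound A (L.length x)) → List Bool
pathOutput A x p = readOut (proj₂ (finalConfig A x p))

SolvesAvoid : ∀ {n m} → NPAlgorithm → Circuit n m → Set
SolvesAvoid {n} {m} A C =
  (Σ (Vec Bool (timeBound A (L.length (encode C)))) λ p → AcceptingPath A (encode C) p) ×
  (∀ p → AcceptingPath A (encode C) p →
     (L.length (pathOutput A (encode C) p) ≡ m) × ¬ InRange C (pathOutput A (encode C) p))

FailsAvoid : ∀ {n m} → NPAlgorithm → Circuit n m → Set
FailsAvoid A C = ¬ SolvesAvoid A C

{-# OPTIONS --safe #-}
-- Suppose A solved range avoidance on every h_key ∘ G. The nondeterministic circuit D guesses, on input y, a
-- key and a computation path of A on the code of h_key ∘ G, and accepts if the path accepts with output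
-- h_key y. It has polynomial size: the code of h_key ∘ G, hence A's initial configuration, is obtained from
-- the key by wiring alone, and each step of A is simulated on tape windows that shrink by one cell per step.
-- D rejects every G x, since otherwise A's output h_key (G x) would lie in the range. If D rejected a set S
-- of at least 4 ^ m strings, a second-moment argument for the pairwise independent family would give a key
-- with h_key S = {0,1}^m, and then D would accept some y ∈ S hashing to A's output for that key. So D accepts
-- all but fewer than 4 ^ m ≤ 2 ^ N / 2 strings, contradicting the demi-bits property; as there are finitely
-- many keys, one on which A fails can be found by search.

module Submission where

open import Defs
open import Data.Bool using (Bool; true; false; _∧_; _∨_; not; if_then_else_)
open import Data.Bool.Properties using (T-≡; ¬-not)
open import Data.Fin using (Fin; zero; suc; toℕ)
open import Data.Fin.Properties using (toℕ<n)
open import Data.List as L using (List)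
import Data.List.Properties as LP
open import Data.List.Membership.Propositional using (_∈_; lose)
open import Data.List.Membership.Propositional.Properties using (∈-++⁺ˡ; ∈-++⁺ʳ; ∈-map⁺)
import Data.List.Relation.Unary.All as All
open import Data.List.Relation.Unary.Any as Any using (here; there)
open import Data.List.Relation.Unary.Any.Properties using (any⁺; any⁻)
open import Data.Maybe as Maybe using (Maybe; just; nothing; fromMaybe; is-just)
open import Data.Nat using (ℕ; zero; suc; _+_; _*_; _^_; _≤_; _<_; s≤s; z≤n; z<s; _≟_; _≡ᵇ_; >-nonZero)
open import Data.Nat.Properties
open import Data.Nat.Tactic.RingSolver using (solve-∀)
open import Data.Product using (Σ; _×_; _,_; proj₁; proj₂)
open import Data.Sum using (_⊎_; inj₁; inj₂; [_,_]′; map₂)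
open import Data.Vec as V using (Vec; []; _∷_; _++_; lookup; tabulate; map; take; drop; head; tail; init; allFin)
import Data.Vec.Properties as VP
open import Function using (_∘_; id; case_of_)
open import Function.Bundles using (_⇔_; mk⇔; Equivalence)
open import Relation.Binary.PropositionalEquality
open import Relation.Nullary using (¬_; Dec; yes; no; contradiction)
open import Relation.Nullary.Decidable using (map′; ¬?; _×-dec_; _→-dec_; decidable-stable)

private
  variable
    A B : Set
    a b c k l n w w₁ w₂ : ℕ
    s₁ s₂ : ℕ

init-map : (g : A → B) (v : Vec A (suc n)) → init (map g v) ≡ map g (init v)
init-map {n = zero}  g (x ∷ []) = refl
init-map {n = suc n} g (x ∷ v)  = cong (g x ∷_) (init-map g v)

take-++ : ∀ {m} (x : Vec A m) (y : Vec A n) → take m (x ++ y) ≡ x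
take-++ {m = m} x y = VP.++-injectiveˡ _ x (VP.take++drop≡id m (x ++ y))

drop-++ : ∀ {m} (x : Vec A m) (y : Vec A n) → drop m (x ++ y) ≡ y
drop-++ {m = m} x y = VP.++-injectiveʳ (take m (x ++ y)) x (VP.take++drop≡id m (x ++ y))

head∷tail : (v : Vec A (suc n)) → head v ∷ tail v ≡ v
head∷tail (x ∷ v) = refl

m+o≡n⇒m≤n : ∀ {m} o → m + o ≡ n → m ≤ n
m+o≡n⇒m≤n {m = m} o refl = m≤m+n m o

∧-true : ∀ {x y} → x ∧ y ≡ true → (x ≡ true) × (y ≡ true)
∧-true {true} {true} _ = refl , refl

-- Composition and fan-out of circuits

infixl 5 _▷▷_
_▷▷_ : Gates n w₁ → Gates w₁ w → Gates n w
gs ▷▷ input    = gs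
gs ▷▷ (hs ▷ g) = (gs ▷▷ hs) ▷ g

evalGates-▷▷ : (gs : Gates n w₁) (hs : Gates w₁ w) (x : Vec Bool n) →
  evalGates (gs ▷▷ hs) x ≡ evalGates hs (evalGates gs x)
evalGates-▷▷ gs input    x = refl
evalGates-▷▷ gs (hs ▷ g) x = cong (λ v → evalGate g v ∷ v) (evalGates-▷▷ gs hs x)

inputWire : Gates n w → Fin n → Fin w
inputWire input    i = i
inputWire (gs ▷ _) i = suc (inputWire gs i)

lookup-inputWire : (gs : Gates n w) (x : Vec Bool n) (i : Fin n) →
  lookup (evalGates gs x) (inputWire gs i) ≡ lookup x i
lookup-inputWire input    x i = refl
lookup-inputWire (gs ▷ _) x i = lookup-inputWire gs x i

graft-▷▷ : (gs : Gates n w₁) (ρ : Fin k → Fin w₁) (hs : Gates k w₂) →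
  let (w , hs′ , σ) = graft input ρ hs in graft gs ρ hs ≡ (w , gs ▷▷ hs′ , σ)
graft-▷▷ gs ρ input    = refl
graft-▷▷ gs ρ (hs ▷ g) rewrite graft-▷▷ gs ρ hs = refl

graft-wires : (gs : Gates n w₁) (ρ : Fin k → Fin w₁) (hs : Gates k w₂) →
  proj₁ (graft gs ρ hs) + k ≡ w₁ + w₂
graft-wires gs ρ input = refl
graft-wires {w₁ = w₁} {w₂ = suc w₂} gs ρ (hs ▷ g) = trans (cong suc (graft-wires gs ρ hs)) (sym (+-suc w₁ w₂))

evalGate-mapGate : (σ : Fin w₁ → Fin w₂) (g : Gate w₁) (u : Vec Bool w₂) (v : Vec Bool w₁) →
  (∀ i → lookup u (σ i) ≡ lookup v i) → evalGate (mapGate σ g) u ≡ evalGate g v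
evalGate-mapGate σ (AND i j) u v eq = cong₂ _∧_ (eq i) (eq j)
evalGate-mapGate σ (OR i j)  u v eq = cong₂ _∨_ (eq i) (eq j)
evalGate-mapGate σ (NOT i)   u v eq = cong not (eq i)
evalGate-mapGate σ (CONST x) u v eq = refl

lookup-graft : (gs : Gates n w₁) (ρ : Fin k → Fin w₁) (hs : Gates k w₂) (x : Vec Bool n) (j : Fin w₂) →
  lookup (evalGates (proj₁ (proj₂ (graft gs ρ hs))) x) (proj₂ (proj₂ (graft gs ρ hs)) j)
  ≡ lookup (evalGates hs (map (lookup (evalGates gs x) ∘ ρ) (allFin k))) j
lookup-graft {k = k} gs ρ input x j =
  sym (trans (VP.lookup-map j _ (allFin k)) (cong (lookup (evalGates gs x) ∘ ρ) (VP.lookup-allFin j)))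
lookup-graft gs ρ (hs ▷ g) x zero    = evalGate-mapGate _ g _ _ (lookup-graft gs ρ hs x)
lookup-graft gs ρ (hs ▷ g) x (suc j) = lookup-graft gs ρ hs x j

eval-compose : (D : Circuit b c) (C : Circuit a b) (x : Vec Bool a) →
  eval (compose D C) x ≡ eval D (eval C x)
eval-compose D C x = begin
  map (lookup (evalGates hs x)) (map σ (outs D))
    ≡⟨ VP.map-∘ _ σ (outs D) ⟨
  map (lookup (evalGates hs x) ∘ σ) (outs D)
    ≡⟨ VP.map-cong (lookup-graft (gates C) (lookup (outs C)) (gates D) x) (outs D) ⟩
  eval D (map (lookup ev ∘ lookup (outs C)) (allFin _))
    ≡⟨ cong (eval D) (VP.map-∘ _ _ (allFin _)) ⟩
  eval D (map (lookup ev) (map (lookup (outs C)) (allFin _)))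
    ≡⟨ cong (eval D ∘ map (lookup ev)) (VP.map-lookup-allFin (outs C)) ⟩
  eval D (eval C x) ∎
  where
  open ≡-Reasoning
  hs = proj₁ (proj₂ (graft (gates C) (lookup (outs C)) (gates D)))
  σ = proj₂ (proj₂ (graft (gates C) (lookup (outs C)) (gates D)))
  ev = evalGates (gates C) x

size-compose : (D : Circuit b c) (C : Circuit a b) → size (compose D C) ≤ size C + size D
size-compose {b = b} D C =
  ≤-trans (m≤m+n _ b) (≤-reflexive (graft-wires (gates C) (lookup (outs C)) (gates D)))

private
  fanoutGraft : (C : Circuit a b) (D : Circuit a c) →
    Σ ℕ λ w → Gates (wires C) w × (Fin (wires D) → Fin w)
  fanoutGraft C D = graft input (inputWire (gates C)) (gates D)

fanout : Circuit a b → Circuit a c → Circuit a (b + c)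
fanout C D = circuit (proj₁ r) (gates C ▷▷ proj₁ (proj₂ r))
                     (map (inputWire (proj₁ (proj₂ r))) (outs C) ++ map (proj₂ (proj₂ r)) (outs D))
  where r = fanoutGraft C D

eval-fanout : (C : Circuit a b) (D : Circuit a c) (x : Vec Bool a) →
  eval (fanout C D) x ≡ eval C x ++ eval D x
eval-fanout {a = a} C D x = begin
  map (lookup (evalGates (gates C ▷▷ hs) x)) (map (inputWire hs) (outs C) ++ map σ (outs D))
    ≡⟨ cong (λ E → map (lookup E) (map (inputWire hs) (outs C) ++ map σ (outs D)))
            (evalGates-▷▷ (gates C) hs x) ⟩
  map (lookup E) (map (inputWire hs) (outs C) ++ map σ (outs D))
    ≡⟨ VP.map-++ (lookup E) (map (inputWire hs) (outs C)) (map σ (outs D)) ⟩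
  map (lookup E) (map (inputWire hs) (outs C)) ++ map (lookup E) (map σ (outs D))
    ≡⟨ cong₂ _++_ (trans (sym (VP.map-∘ _ _ (outs C))) (VP.map-cong (lookup-inputWire hs ev) (outs C)))
                  (trans (sym (VP.map-∘ _ _ (outs D)))
                         (VP.map-cong (lookup-graft input (inputWire (gates C)) (gates D) ev) (outs D))) ⟩
  eval C x ++ eval D (map (lookup ev ∘ inputWire (gates C)) (allFin a))
    ≡⟨ cong (λ u → eval C x ++ eval D u)
            (trans (VP.map-cong (lookup-inputWire (gates C) x) (allFin a)) (VP.map-lookup-allFin x)) ⟩
  eval C x ++ eval D x ∎
  where
  open ≡-Reasoning
  hs = proj₁ (proj₂ (fanoutGraft C D))
  σ = proj₂ (proj₂ (fanoutGraft C D))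
  ev = evalGates (gates C) x
  E = evalGates hs ev

size-fanout : (C : Circuit a b) (D : Circuit a c) → size (fanout C D) ≤ size C + size D
size-fanout {a = a} C D =
  ≤-trans (m≤m+n _ a) (≤-reflexive (graft-wires input (inputWire (gates C)) (gates D)))

record Computes {a b : ℕ} (bound : ℕ) (f : Vec Bool a → Vec Bool b) : Set where
  field
    circ      : Circuit a b
    eval-circ : eval circ ≗ f
    size-circ : size circ ≤ bound
open Computes public

computes-≗ : {f g : Vec Bool a → Vec Bool b} → f ≗ g → Computes s₁ f → Computes s₁ g
computes-≗ f≗g F = record
  { circ = circ F ; eval-circ = λ x → trans (eval-circ F x) (f≗g x) ; size-circ = size-circ F }

computes-≤ : {f : Vec Bool a → Vec Bool b} → s₁ ≤ s₂ → Computes s₁ f → Computes s₂ f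
computes-≤ le F = record
  { circ = circ F ; eval-circ = eval-circ F ; size-circ = ≤-trans (size-circ F) le }

infixr 9 _∘ᶜ_
_∘ᶜ_ : {g : Vec Bool b → Vec Bool c} {f : Vec Bool a → Vec Bool b} →
  Computes s₂ g → Computes s₁ f → Computes (s₁ + s₂) (g ∘ f)
G ∘ᶜ F = record
  { circ      = compose (circ G) (circ F)
  ; eval-circ = λ x → trans (eval-compose (circ G) (circ F) x)
                            (trans (cong (eval (circ G)) (eval-circ F x)) (eval-circ G _))
  ; size-circ = ≤-trans (size-compose (circ G) (circ F)) (+-mono-≤ (size-circ F) (size-circ G))
  }

infixr 4 _&ᶜ_
_&ᶜ_ : {f : Vec Bool a → Vec Bool b} {g : Vec Bool a → Vec Bool c} →
  Computes s₁ f → Computes s₂ g → Computes (s₁ + s₂) (λ x → f x ++ g x)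
F &ᶜ G = record
  { circ      = fanout (circ F) (circ G)
  ; eval-circ = λ x → trans (eval-fanout (circ F) (circ G) x) (cong₂ _++_ (eval-circ F x) (eval-circ G x))
  ; size-circ = ≤-trans (size-fanout (circ F) (circ G)) (+-mono-≤ (size-circ F) (size-circ G))
  }

-- A map Vec A a → Vec A b natural in A only moves, copies and drops positions; applied to
-- the vector of input wires it yields the output wires of a circuit without gates.
record Rewiring (a b : ℕ) : Set₁ where
  field
    apply   : ∀ {A : Set} → Vec A a → Vec A b
    natural : ∀ {A B : Set} (g : A → B) (v : Vec A a) → apply (map g v) ≡ map g (apply v)
open Rewiring public

infixr 9 _∘ᴿ_
_∘ᴿ_ : Rewiring b c → Rewiring a b → Rewiring a c
R ∘ᴿ S = record
  { apply   = apply R ∘ apply S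
  ; natural = λ g v → trans (cong (apply R) (natural S g v)) (natural R g (apply S v))
  }

infixr 5 _⊕ᴿ_
_⊕ᴿ_ : Rewiring a b → Rewiring a c → Rewiring a (b + c)
R ⊕ᴿ S = record
  { apply   = λ v → apply R v ++ apply S v
  ; natural = λ g v → trans (cong₂ _++_ (natural R g v) (natural S g v))
                            (sym (VP.map-++ g (apply R v) (apply S v)))
  }

idᴿ : Rewiring n n
idᴿ = record { apply = id ; natural = λ _ _ → refl }

takeᴿ : ∀ m {n} → Rewiring (m + n) m
takeᴿ m = record { apply = take m ; natural = λ g v → VP.take-map g m v }

dropᴿ : ∀ m {n} → Rewiring (m + n) n
dropᴿ m = record { apply = drop m ; natural = λ g v → VP.drop-map g m v }

headᴿ : Rewiring (suc n) 1
headᴿ = record { apply = λ v → head v ∷ [] ; natural = λ { g (x ∷ v) → refl } }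

tailᴿ : Rewiring (suc n) n
tailᴿ = record { apply = tail ; natural = λ { g (x ∷ v) → refl } }

initᴿ : Rewiring (suc n) n
initᴿ = record { apply = init ; natural = init-map }

lookupᴿ : Fin n → Rewiring n 1
lookupᴿ i = record
  { apply = λ v → lookup v i ∷ [] ; natural = λ g v → cong (_∷ []) (VP.lookup-map i g v) }

rewiring : (R : Rewiring a b) → Computes a (apply R)
rewiring {a} R = record
  { circ      = circuit a input (apply R (allFin a))
  ; eval-circ = λ x → trans (sym (natural R (lookup x) (allFin a))) (cong (apply R) (VP.map-lookup-allFin x))
  ; size-circ = ≤-refl
  }

instantiate : Vec Bool a → Bool ⊎ Fin a → Bool
instantiate x = [ id , lookup x ]′

templateᶜ : (tm : Vec (Bool ⊎ Fin a) k) → Computes (2 + a) (λ x → map (instantiate x) tm)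
templateᶜ {a} tm = record
  { circ      = circuit (2 + a) ((input ▷ CONST false) ▷ CONST true) (map wireOf tm)
  ; eval-circ = λ x → trans (sym (VP.map-∘ _ _ tm)) (VP.map-cong (eval-wireOf x) tm)
  ; size-circ = ≤-refl
  }
  where
  wireOf : Bool ⊎ Fin a → Fin (2 + a)
  wireOf (inj₁ true)  = zero
  wireOf (inj₁ false) = suc zero
  wireOf (inj₂ i)     = suc (suc i)
  eval-wireOf : ∀ x (b : Bool ⊎ Fin a) → lookup (true ∷ false ∷ x) (wireOf b) ≡ instantiate x b
  eval-wireOf x (inj₁ true)  = refl
  eval-wireOf x (inj₁ false) = refl
  eval-wireOf x (inj₂ i)     = refl

constᶜ : (v : Vec Bool k) → Computes (2 + a) (λ (_ : Vec Bool a) → v)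
constᶜ v = computes-≗ (λ x → trans (sym (VP.map-∘ _ inj₁ v)) (VP.map-id v)) (templateᶜ (map inj₁ v))

circuitᶜ : (C : Circuit a b) → Computes (size C) (eval C)
circuitᶜ C = record { circ = C ; eval-circ = λ _ → refl ; size-circ = ≤-refl }

-- Multiplexers and lookup tables

select : ∀ k → Vec Bool (suc (k + k)) → Vec Bool k
select k (s ∷ v) = if s then take k v else drop k v

select-++ : ∀ s (x y : Vec Bool k) → select k (s ∷ x ++ y) ≡ (if s then x else y)
select-++ true  x y = take-++ x y
select-++ false x y = drop-++ x y

-- (s ∧ x) ∨ (¬ s ∧ y)
select₁ : Computes 7 (select 1)
select₁ = record
  { circ      = circuit 7 ((((input ▷ AND zero (suc zero)) ▷ NOT (suc zero))
                             ▷ AND zero (suc (suc (suc (suc zero))))) ▷ OR zero (suc (suc zero)))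
                          (zero ∷ [])
  ; eval-circ = λ { (true  ∷ x ∷ y     ∷ []) → refl
                  ; (false ∷ x ∷ false ∷ []) → refl
                  ; (false ∷ x ∷ true  ∷ []) → refl }
  ; size-circ = ≤-refl
  }

selectᶜ : ∀ k → Computes (20 * suc k * suc k) (select k)
selectᶜ zero    = computes-≤ (m+o≡n⇒m≤n 17 refl)
  (computes-≗ (λ { (true ∷ []) → refl ; (false ∷ []) → refl }) (constᶜ []))
selectᶜ (suc k) = computes-≤ (m+o≡n⇒m≤n (36 * k + 47) (size-eq k)) (computes-≗ select-suc
  (select₁ ∘ᶜ rewiring (headᴿ ⊕ᴿ headᴿ ∘ᴿ tailᴿ ⊕ᴿ headᴿ ∘ᴿ dropᴿ (suc k) ∘ᴿ tailᴿ)
   &ᶜ selectᶜ k ∘ᶜ rewiring (headᴿ ⊕ᴿ tailᴿ ∘ᴿ takeᴿ (suc k) ∘ᴿ tailᴿ ⊕ᴿ tailᴿ ∘ᴿ dropᴿ (suc k) ∘ᴿ tailᴿ)))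
  where
  select-suc : (λ v → select 1 (head v ∷ head (tail v) ∷ head (drop (suc k) (tail v)) ∷ [])
                      ++ select k (head v ∷ tail (take (suc k) (tail v)) ++ tail (drop (suc k) (tail v))))
               ≗ select (suc k)
  select-suc (true ∷ x ∷ u)  = cong (x ∷_) (take-++ (take k u) _)
  select-suc (false ∷ x ∷ u) = trans (cong (head (drop k u) ∷_) (drop-++ (take k u) (tail (drop k u))))
                                     (head∷tail (drop k u))
  size-eq : ∀ k → suc (suc k + suc k) + 7 + (suc (suc k + suc k) + 20 * suc k * suc k) + (36 * k + 47)
                  ≡ 20 * suc (suc k) * suc (suc k)
  size-eq = solve-∀

select₃ : ∀ k → Vec Bool (2 + (k + (k + k))) → Vec Bool k
select₃ k (l ∷ r ∷ v) = if l then take k v else select k (r ∷ drop k v)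

select₃ᶜ : ∀ k → Computes (50 * suc k * suc k) (select₃ k)
select₃ᶜ k = computes-≤ (m+o≡n⇒m≤n (10 * k * k + 14 * k + 6) (size-eq k))
  (computes-≗ (λ { (l ∷ r ∷ v) → select-++ l (take k v) _ })
    (selectᶜ k ∘ᶜ (rewiring (headᴿ ⊕ᴿ takeᴿ k ∘ᴿ tailᴿ ∘ᴿ tailᴿ)
                   &ᶜ selectᶜ k ∘ᶜ rewiring (headᴿ ∘ᴿ tailᴿ ⊕ᴿ dropᴿ k ∘ᴿ tailᴿ ∘ᴿ tailᴿ))))
  where
  size-eq : ∀ k → (2 + (k + (k + k)) + (2 + (k + (k + k)) + 20 * suc k * suc k)) + 20 * suc k * suc k
                  + (10 * k * k + 14 * k + 6) ≡ 50 * suc k * suc k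
  size-eq = solve-∀

tableSize : ℕ → ℕ → ℕ
tableSize zero    q = 2
tableSize (suc p) q = (suc p + ((suc p + tableSize p q) + (suc p + tableSize p q))) + 20 * suc q * suc q

-- The Shannon expansion on the first input bit. The size is exponential in p, so tables are used
-- only for a number of inputs that does not grow with n.
table : ∀ p q (F : Vec Bool p → Vec Bool q) → Computes (tableSize p q) F
table zero    q F = computes-≗ (λ { [] → refl }) (constᶜ (F []))
table (suc p) q F =
  computes-≗ (λ { (b ∷ x) → trans (select-++ b (F (true ∷ x)) (F (false ∷ x))) (expand b x) })
    (selectᶜ q ∘ᶜ (rewiring headᴿ &ᶜ table p q (F ∘ (true ∷_)) ∘ᶜ rewiring tailᴿ
                                  &ᶜ table p q (F ∘ (false ∷_)) ∘ᶜ rewiring tailᴿ))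
  where
  expand : ∀ b x → (if b then F (true ∷ x) else F (false ∷ x)) ≡ F (b ∷ x)
  expand true  x = refl
  expand false x = refl

conj : Vec Bool 2 → Vec Bool 1
conj (x ∷ y ∷ []) = x ∧ y ∷ []

oneHot : Fin k → Vec Bool k
oneHot {suc k} zero = true ∷ V.replicate k false
oneHot (suc i)      = false ∷ oneHot i

firstTrue : Vec Bool k → Maybe (Fin k)
firstTrue []          = nothing
firstTrue (true ∷ v)  = just zero
firstTrue (false ∷ v) = Maybe.map suc (firstTrue v)

firstTrue-oneHot : (i : Fin k) → firstTrue (oneHot i) ≡ just i
firstTrue-oneHot zero    = refl
firstTrue-oneHot (suc i) = cong (Maybe.map suc) (firstTrue-oneHot i)

lookup-oneHot : (i : Fin k) → lookup (oneHot i) i ≡ true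
lookup-oneHot zero    = refl
lookup-oneHot (suc i) = lookup-oneHot i

lookup-oneHot⇒≡ : (i j : Fin k) → lookup (oneHot i) j ≡ true → i ≡ j
lookup-oneHot⇒≡ zero    zero    _  = refl
lookup-oneHot⇒≡ zero    (suc j) eq with () ← trans (sym (VP.lookup-replicate j false)) eq
lookup-oneHot⇒≡ (suc i) (suc j) eq = cong suc (lookup-oneHot⇒≡ i j eq)

symBits : Sym → Vec Bool 2
symBits h = is-just h ∷ fromMaybe false h ∷ []

decodeSym : Vec Bool 2 → Sym
decodeSym (true  ∷ v ∷ []) = just v
decodeSym (false ∷ _ ∷ []) = nothing

decodeSym-symBits : (h : Sym) → decodeSym (symBits h) ≡ h
decodeSym-symBits (just _) = refl
decodeSym-symBits nothing  = refl

moveBits : Move → Vec Bool 2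
moveBits moveL = true  ∷ false ∷ []
moveBits moveR = false ∷ true  ∷ []
moveBits stay  = false ∷ false ∷ []

byMove : Move → A → A → A → A
byMove moveL x y z = x
byMove moveR x y z = y
byMove stay  x y z = z

select₃-moveBits : ∀ mv (x y z : Vec Bool k) → select₃ k (moveBits mv ++ (x ++ (y ++ z))) ≡ byMove mv x y z
select₃-moveBits     moveL x y z = take-++ x (y ++ z)
select₃-moveBits {k} moveR x y z = trans (cong (take k) (drop-++ x (y ++ z))) (take-++ y z)
select₃-moveBits {k} stay  x y z = trans (cong (drop k) (drop-++ x (y ++ z))) (drop-++ y z)

pad : ∀ k → List (Maybe A) → Vec (Maybe A) k
pad zero    _          = []
pad (suc k) L.[]       = nothing ∷ pad k L.[]
pad (suc k) (x L.∷ xs) = x ∷ pad k xs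

pad-map : (g : A → B) → ∀ k (xs : List (Maybe A)) →
  map (Maybe.map g) (pad k xs) ≡ pad k (L.map (Maybe.map g) xs)
pad-map g zero    xs         = refl
pad-map g (suc k) L.[]       = cong (nothing ∷_) (pad-map g k L.[])
pad-map g (suc k) (x L.∷ xs) = cong (Maybe.map g x ∷_) (pad-map g k xs)

init-pad : ∀ k (xs : List (Maybe A)) → init (pad (suc k) xs) ≡ pad k xs
init-pad zero    L.[]       = refl
init-pad zero    (x L.∷ xs) = refl
init-pad (suc k) L.[]       = cong (nothing ∷_) (init-pad k L.[])
init-pad (suc k) (x L.∷ xs) = cong (x ∷_) (init-pad k xs)

push : A → Vec A (suc k) → Vec A k
push x v = init (x ∷ init v)

pad-∷ : ∀ k (x : Maybe A) xs → pad k (x L.∷ xs) ≡ push x (pad (suc k) xs)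
pad-∷ k x xs = trans (sym (init-pad k (x L.∷ xs))) (cong (λ v → init (x ∷ v)) (sym (init-pad k xs)))

private
  leftᴿ : Rewiring (1 + (suc a + suc b)) (suc a)
  leftᴿ {a} = takeᴿ (suc a) ∘ᴿ tailᴿ

  rightᴿ : Rewiring (1 + (suc a + suc b)) (suc b)
  rightᴿ {a} = dropᴿ (suc a) ∘ᴿ tailᴿ

  pushᴿ : Rewiring (1 + (suc a + suc b)) (suc k) → Rewiring (1 + (suc a + suc b)) k
  pushᴿ X = initᴿ ∘ᴿ (headᴿ ⊕ᴿ initᴿ ∘ᴿ X)

-- The cells after writing a symbol and moving the head, acting on (written symbol, left window,
-- right window). Each window loses its outermost cell, whose new content is not known.
shift : ∀ a b → Move → Rewiring (1 + (suc a + suc b)) (1 + (a + b))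
shift a b moveL = headᴿ ∘ᴿ leftᴿ ⊕ᴿ tailᴿ ∘ᴿ leftᴿ ⊕ᴿ pushᴿ rightᴿ
shift a b moveR = headᴿ ∘ᴿ rightᴿ ⊕ᴿ pushᴿ leftᴿ ⊕ᴿ tailᴿ ∘ᴿ rightᴿ
shift a b stay  = headᴿ ⊕ᴿ initᴿ ∘ᴿ leftᴿ ⊕ᴿ initᴿ ∘ᴿ rightᴿ

shift-++ : ∀ mv (x : A) (L : Vec A (suc a)) (R : Vec A (suc b)) →
  apply (shift a b mv) (x ∷ L ++ R)
  ≡ byMove mv (head L ∷ tail L ++ push x R) (head R ∷ push x L ++ tail R) (x ∷ init L ++ init R)
shift-++ moveL x L R rewrite take-++ L R | drop-++ L R = refl
shift-++ moveR x L R rewrite take-++ L R | drop-++ L R = refl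
shift-++ stay  x L R rewrite take-++ L R | drop-++ L R = refl

planeInputsᴿ : ∀ a b → Rewiring (2 + (1 + (suc a + suc b))) (2 + (1 + (a + b) + (1 + (a + b) + (1 + (a + b)))))
planeInputsᴿ a b = takeᴿ 2 ⊕ᴿ shift a b moveL ∘ᴿ dropᴿ 2 ⊕ᴿ shift a b moveR ∘ᴿ dropᴿ 2
                           ⊕ᴿ shift a b stay ∘ᴿ dropᴿ 2

-- One plane of the cells after a step: all three candidate shifts are wired, the move bits select one.
planeUpdate : ∀ a b → Vec Bool (2 + (1 + (suc a + suc b))) → Vec Bool (1 + (a + b))
planeUpdate a b = select₃ (1 + (a + b)) ∘ apply (planeInputsᴿ a b)

planeUpdateᶜ : ∀ a b →
  Computes (2 + (1 + (suc a + suc b)) + 50 * suc (1 + (a + b)) * suc (1 + (a + b))) (planeUpdate a b)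
planeUpdateᶜ a b = select₃ᶜ (1 + (a + b)) ∘ᶜ rewiring (planeInputsᴿ a b)

planeUpdate-moveBits : ∀ mv (v : Vec Bool (1 + (suc a + suc b))) →
  planeUpdate a b (moveBits mv ++ v) ≡ apply (shift a b mv) v
planeUpdate-moveBits {a} {b} mv v = selected mv
  where
  shifted : Move → Vec Bool (1 + (a + b))
  shifted mv = apply (shift a b mv) v
  selected : ∀ mv → planeUpdate a b (moveBits mv ++ v) ≡ shifted mv
  selected moveL = select₃-moveBits moveL (shifted moveL) (shifted moveR) (shifted stay)
  selected moveR = select₃-moveBits moveR (shifted moveL) (shifted moveR) (shifted stay)
  selected stay  = select₃-moveBits stay  (shifted moveL) (shifted moveR) (shifted stay)

reads : ∀ k → Vec Bool (suc k) → Vec Bool (suc k) → Vec Bool k → Bool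
reads zero    (j ∷ []) _        []       = not j
reads (suc k) (j ∷ js) (v ∷ vs) (z ∷ zs) = (j ∧ (if v then z else not z)) ∧ reads k js vs zs

reads⇒takeBits : ∀ k cells (z : Vec Bool k) →
  reads k (map is-just (pad (suc k) cells)) (map (fromMaybe false) (pad (suc k) cells)) z ≡ true →
  takeBits cells ≡ V.toList z
reads⇒takeBits zero    L.[]                  []       _  = refl
reads⇒takeBits zero    (nothing L.∷ cells)   []       _  = refl
reads⇒takeBits (suc k) (just true L.∷ cells)  (true ∷ z)  eq = cong (true L.∷_) (reads⇒takeBits k cells z eq)
reads⇒takeBits (suc k) (just false L.∷ cells) (false ∷ z) eq = cong (false L.∷_) (reads⇒takeBits k cells z eq)
reads⇒takeBits zero    (just _ L.∷ _)        []       ()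
reads⇒takeBits (suc k) L.[]                  (_ ∷ _)  ()
reads⇒takeBits (suc k) (nothing L.∷ _)       (_ ∷ _)  ()
reads⇒takeBits (suc k) (just true L.∷ _)     (false ∷ z) ()
reads⇒takeBits (suc k) (just false L.∷ _)    (true ∷ z)  ()

takeBits⇒reads : ∀ k cells (z : Vec Bool k) → takeBits cells ≡ V.toList z →
  reads k (map is-just (pad (suc k) cells)) (map (fromMaybe false) (pad (suc k) cells)) z ≡ true
takeBits⇒reads zero    L.[]                  []       _  = refl
takeBits⇒reads zero    (nothing L.∷ cells)   []       _  = refl
takeBits⇒reads (suc k) (just true L.∷ cells)  (true ∷ z)  eq = takeBits⇒reads k cells z (LP.∷-injectiveʳ eq)
takeBits⇒reads (suc k) (just false L.∷ cells) (false ∷ z) eq = takeBits⇒reads k cells z (LP.∷-injectiveʳ eq)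
takeBits⇒reads (suc k) (just true L.∷ _)     (false ∷ z) ()
takeBits⇒reads (suc k) (just false L.∷ _)    (true ∷ z)  ()

readCell : Vec Bool 4 → Vec Bool 1
readCell (j ∷ v ∷ z ∷ r ∷ []) = (j ∧ (if v then z else not z)) ∧ r ∷ []

private
  cellᴿ : ∀ k → Rewiring ((suc (suc k) + suc (suc k)) + suc k) 3
  cellᴿ k = headᴿ ∘ᴿ planes ⊕ᴿ headᴿ ∘ᴿ dropᴿ (2 + k) ∘ᴿ planes ⊕ᴿ headᴿ ∘ᴿ dropᴿ (2 + k + (2 + k))
    where planes = takeᴿ (suc (suc k) + suc (suc k))

  restᴿ : ∀ k → Rewiring ((suc (suc k) + suc (suc k)) + suc k) ((suc k + suc k) + k)
  restᴿ k = (tailᴿ ∘ᴿ takeᴿ (suc (suc k)) ∘ᴿ planes ⊕ᴿ tailᴿ ∘ᴿ dropᴿ (suc (suc k)) ∘ᴿ planes)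
            ⊕ᴿ tailᴿ ∘ᴿ dropᴿ (suc (suc k) + suc (suc k))
    where planes = takeᴿ (suc (suc k) + suc (suc k))

readsBits : ∀ k → Vec Bool ((suc k + suc k) + k) → Vec Bool 1
readsBits zero    x = not (head x) ∷ []
readsBits (suc k) x = readCell (apply (cellᴿ k) x ++ readsBits k (apply (restᴿ k) x))

readsBits-correct : ∀ k js vs (zs : Vec Bool k) → readsBits k ((js ++ vs) ++ zs) ≡ reads k js vs zs ∷ []
readsBits-correct zero    (j ∷ []) vs []       = refl
readsBits-correct (suc k) (j ∷ js) (v ∷ vs) (z ∷ zs) = begin
  readCell (apply (cellᴿ k) x ++ readsBits k (apply (restᴿ k) x))
    ≡⟨ cong₂ (λ P Z → readCell ((head P ∷ head (drop (2 + k) P) ∷ head Z ∷ [])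
                                ++ readsBits k ((tail (take (2 + k) P) ++ tail (drop (2 + k) P)) ++ tail Z)))
             (take-++ (j ∷ js ++ v ∷ vs) (z ∷ zs)) (drop-++ (j ∷ js ++ v ∷ vs) (z ∷ zs)) ⟩
  readCell ((j ∷ head (drop (2 + k) (j ∷ js ++ v ∷ vs)) ∷ z ∷ [])
            ++ readsBits k ((tail (take (2 + k) (j ∷ js ++ v ∷ vs)) ++ tail (drop (2 + k) (j ∷ js ++ v ∷ vs))) ++ zs))
    ≡⟨ cong₂ (λ T D → readCell ((j ∷ head D ∷ z ∷ []) ++ readsBits k ((tail T ++ tail D) ++ zs)))
             (take-++ (j ∷ js) (v ∷ vs)) (drop-++ (j ∷ js) (v ∷ vs)) ⟩
  readCell (j ∷ v ∷ z ∷ readsBits k ((js ++ vs) ++ zs))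
    ≡⟨ cong (λ r → readCell (j ∷ v ∷ z ∷ r)) (readsBits-correct k js vs zs) ⟩
  reads (suc k) (j ∷ js) (v ∷ vs) (z ∷ zs) ∷ [] ∎
  where
  open ≡-Reasoning
  x = ((j ∷ js) ++ (v ∷ vs)) ++ (z ∷ zs)

readsSize : ℕ → ℕ
readsSize zero    = tableSize 2 1
readsSize (suc k) = (I + (I + readsSize k)) + tableSize 4 1
  where I = (suc (suc k) + suc (suc k)) + suc k

readsᶜ : ∀ k → Computes (readsSize k) (readsBits k)
readsᶜ zero    = table 2 1 (λ x → not (head x) ∷ [])
readsᶜ (suc k) = table 4 1 readCell ∘ᶜ (rewiring (cellᴿ k) &ᶜ readsᶜ k ∘ᶜ rewiring (restᴿ k))

readsSize-bound : ∀ k → readsSize k ≤ 440 * suc k * suc k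
readsSize-bound zero    = m+o≡n⇒m≤n 180 refl
readsSize-bound (suc k) = begin
  (I + (I + readsSize k)) + 1310       ≤⟨ +-monoˡ-≤ 1310 (+-monoʳ-≤ I (+-monoʳ-≤ I (readsSize-bound k))) ⟩
  (I + (I + 440 * suc k * suc k)) + 1310 ≤⟨ m+o≡n⇒m≤n (874 * k) (arith k) ⟩
  440 * suc (suc k) * suc (suc k)      ∎
  where
  open ≤-Reasoning
  I = (suc (suc k) + suc (suc k)) + suc k
  arith : ∀ k → ((2 + k + (2 + k)) + suc k + ((2 + k + (2 + k)) + suc k + 440 * suc k * suc k)) + 1310 + 874 * k
                ≡ 440 * suc (suc k) * suc (suc k)
  arith = solve-∀

evalGates-consts : (key : Vec Bool l) (y : Vec Bool n) → evalGates (consts key) y ≡ key ++ y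
evalGates-consts []        y = refl
evalGates-consts (b ∷ key) y = cong (b ∷_) (evalGates-consts key y)

eval-hashAfter : (H : Circuit (l + n) b) (key : Vec Bool l) (G : Circuit a n) (x : Vec Bool a) →
  eval (hashAfter H key G) x ≡ eval H (key ++ eval G x)
eval-hashAfter H key G x = begin
  eval (compose H (compose (prependKey key) G)) x       ≡⟨ eval-compose H _ x ⟩
  eval H (eval (compose (prependKey key) G) x)          ≡⟨ cong (eval H) (eval-compose (prependKey key) G x) ⟩
  eval H (map (lookup (evalGates (consts key) (eval G x))) (tabulate id))
    ≡⟨ cong (eval H) (trans (sym (VP.tabulate-∘ _ id)) (VP.tabulate∘lookup _)) ⟩
  eval H (evalGates (consts key) (eval G x))            ≡⟨ cong (eval H) (evalGates-consts key (eval G x)) ⟩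
  eval H (key ++ eval G x)                              ∎
  where open ≡-Reasoning

size-hashAfter : (H : Circuit (l + n) b) (key : Vec Bool l) (G : Circuit a n) →
  size (hashAfter H key G) ≤ size G + (l + n) + size H
size-hashAfter H key G =
  ≤-trans (size-compose H (compose (prependKey key) G)) (+-monoˡ-≤ (size H) (size-compose (prependKey key) G))

constGates : Gates n w → Vec Bool l → Gates n (l + w)
constGates gs []       = gs
constGates gs (b ∷ bs) = constGates gs bs ▷ CONST b

liftRen : ∀ l {k w} → (Fin k → Fin w) → Fin (l + k) → Fin (l + w)
liftRen zero    ρ = ρ
liftRen (suc l) ρ = extRen (liftRen l ρ)

graft-consts : (gs : Gates n w) (ρ : Fin k → Fin w) (key : Vec Bool l) →
  graft gs ρ (consts key) ≡ (l + w , constGates gs key , liftRen l ρ)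
graft-consts gs ρ []        = refl
graft-consts gs ρ (b ∷ key) rewrite graft-consts gs ρ key = refl

keyCode : Vec Bool l → List Bool
keyCode []       = L.[]
keyCode (b ∷ bs) = keyCode bs L.++ encGate (CONST {0} b)

encGates-constGates : (gs : Gates n w) (key : Vec Bool l) →
  encGates (constGates gs key) ≡ encGates gs L.++ keyCode key
encGates-constGates gs []        = sym (LP.++-identityʳ (encGates gs))
encGates-constGates gs (b ∷ key) =
  trans (cong (L._++ _) (encGates-constGates gs key)) (LP.++-assoc (encGates gs) (keyCode key) _)

encGates-▷▷ : (gs : Gates n w₁) (hs : Gates w₁ w) → encGates (gs ▷▷ hs) ≡ encGates gs L.++ encGates hs
encGates-▷▷ gs input    = sym (LP.++-identityʳ (encGates gs))
encGates-▷▷ gs (hs ▷ g) =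
  trans (cong (L._++ encGate g) (encGates-▷▷ gs hs)) (LP.++-assoc (encGates gs) (encGates hs) _)

keyTemplate : ∀ l → List (Bool ⊎ Fin l)
keyTemplate zero    = L.[]
keyTemplate (suc l) = L.map (map₂ suc) (keyTemplate l) L.++ (inj₁ true L.∷ inj₁ true L.∷ inj₂ zero L.∷ L.[])

keyTemplate-instantiate : (key : Vec Bool l) → L.map (instantiate key) (keyTemplate l) ≡ keyCode key
keyTemplate-instantiate []        = refl
keyTemplate-instantiate {suc l} (b ∷ key) =
  trans (LP.map-++ (instantiate (b ∷ key)) (L.map (map₂ suc) (keyTemplate l)) _)
        (cong (L._++ _) (trans (sym (LP.map-∘ (keyTemplate l)))
                               (trans (LP.map-cong (λ { (inj₁ _) → refl ; (inj₂ _) → refl }) (keyTemplate l))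
                                      (keyTemplate-instantiate key))))

-- The code of h_key ∘ G depends on the key only through the constant gates of prependKey key.
module HashAfterCode {l N m : ℕ} (H : Circuit (l + N) m) (G : Circuit n N) where

  private
    innerOuts : Vec (Fin (l + wires G)) (l + N)
    innerOuts = map (liftRen l (lookup (outs G))) (tabulate id)

    outer : Σ ℕ λ w → Gates (l + wires G) w × (Fin (wires H) → Fin w)
    outer = graft input (lookup innerOuts) (gates H)

    outsCode : List Bool
    outsCode = L.concat (V.toList (map encFin (map (proj₂ (proj₂ outer)) (outs H))))

    code : List Bool → List Bool
    code gatesCode = unary n L.++ unary m L.++ unary (proj₁ outer) L.++ gatesCode L.++ outsCode

    prefix suffix : List Bool
    prefix = unary n L.++ unary m L.++ unary (proj₁ outer) L.++ encGates (gates G)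
    suffix = encGates (proj₁ (proj₂ outer)) L.++ outsCode

  template : List (Bool ⊎ Fin l)
  template = L.map inj₁ prefix L.++ (keyTemplate l L.++ L.map inj₁ suffix)

  encode-hashAfter : (key : Vec Bool l) → encode (hashAfter H key G) ≡ L.map (instantiate key) template
  encode-hashAfter key = begin
    encode (compose H (compose (prependKey key) G))
      ≡⟨ cong (encode ∘ compose H) inner ⟩
    encode (compose H (circuit (l + wires G) (constGates (gates G) key) innerOuts))
      ≡⟨ cong (λ (w , hs , σ) → unary n L.++ unary m L.++ unary w L.++ encGates hs
                                L.++ L.concat (V.toList (map encFin (map σ (outs H)))))
              (graft-▷▷ (constGates (gates G) key) (lookup innerOuts) (gates H)) ⟩
    code (encGates (constGates (gates G) key ▷▷ proj₁ (proj₂ outer)))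
      ≡⟨ cong code (trans (encGates-▷▷ (constGates (gates G) key) (proj₁ (proj₂ outer)))
                          (cong (L._++ _) (encGates-constGates (gates G) key))) ⟩
    code ((encGates (gates G) L.++ keyCode key) L.++ encGates (proj₁ (proj₂ outer)))
      ≡⟨ reassociate (unary n) (unary m) (unary (proj₁ outer)) (encGates (gates G)) (keyCode key) _ outsCode ⟩
    prefix L.++ (keyCode key L.++ suffix)
      ≡⟨ cong₂ L._++_ (sym (instantiate-inj₁ prefix))
                      (cong₂ L._++_ (sym (keyTemplate-instantiate key)) (sym (instantiate-inj₁ suffix))) ⟩
    L.map g (L.map inj₁ prefix) L.++ (L.map g (keyTemplate l) L.++ L.map g (L.map inj₁ suffix))
      ≡⟨ trans (LP.map-++ g (L.map inj₁ prefix) _)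
               (cong (L.map g (L.map inj₁ prefix) L.++_) (LP.map-++ g (keyTemplate l) _)) ⟨
    L.map g template ∎
    where
    open ≡-Reasoning
    g = instantiate key
    inner : compose (prependKey key) G ≡ circuit (l + wires G) (constGates (gates G) key) innerOuts
    inner = cong (λ (w , gs , σ) → circuit w gs (map σ (tabulate id))) (graft-consts (gates G) (lookup (outs G)) key)
    instantiate-inj₁ : (xs : List Bool) → L.map g (L.map inj₁ xs) ≡ xs
    instantiate-inj₁ xs = trans (sym (LP.map-∘ xs)) (LP.map-id xs)
    reassociate : ∀ (a b c d k f o : List Bool) →
      a L.++ b L.++ c L.++ ((d L.++ k) L.++ f) L.++ o ≡ (a L.++ b L.++ c L.++ d) L.++ (k L.++ (f L.++ o))
    reassociate a b c d k f o =
      trans (cong (λ z → a L.++ b L.++ c L.++ z) (trans (LP.++-assoc (d L.++ k) f o) (LP.++-assoc d k (f L.++ o))))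
            (sym (trans (LP.++-assoc a _ _) (cong (a L.++_) (trans (LP.++-assoc b _ _) (cong (b L.++_) (LP.++-assoc c d _))))))

-- Simulating a nondeterministic machine

module Simulation (M : NTM) where

  private
    s = NTM.states M

  -- Cells are listed head first, then the left window, then the right window (nearest first);
  -- each plane stores one bit of every cell: whether it is non-blank, and its bit.
  window : ∀ a b → Tape → Vec Sym (1 + (a + b))
  window a b (tape l h r) = h ∷ pad a l ++ pad b r

  planes : Vec Sym k → Vec Bool (k + k)
  planes w = map is-just w ++ map (fromMaybe false) w

  CodeSize : ℕ → ℕ → ℕ
  CodeSize a b = s + (1 + (a + b) + (1 + (a + b)))

  encodeConfig : ∀ a b → Config M → Vec Bool (CodeSize a b)
  encodeConfig a b (q , t) = oneHot q ++ planes (window a b t)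

  transition : Bool → Fin s → Sym → Fin s × Sym × Move
  transition bit q h = if halted M q then (q , h , stay) else NTM.δ M q h bit

  step-transition : ∀ bit q l h r → let X = transition bit q h in
    step M bit (q , tape l h r) ≡ (proj₁ X , move (proj₂ (proj₂ X)) (tape l (proj₁ (proj₂ X)) r))
  step-transition bit q l h r with halted M q
  ... | true  = refl
  ... | false = refl

  decodeState : Vec Bool s → Fin s
  decodeState v = fromMaybe (NTM.start M) (firstTrue v)

  encodeAction : Fin s × Sym × Move → Vec Bool (s + 4)
  encodeAction (q , w , mv) = oneHot q ++ (symBits w ++ moveBits mv)

  -- A total function on bits, as required by table; non-codes decode to arbitrary values.
  transitionBits : Vec Bool (1 + (s + 2)) → Vec Bool (s + 4)
  transitionBits (bit ∷ v) = encodeAction (transition bit (decodeState (take s v)) (decodeSym (drop s v)))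

  transitionBits-correct : ∀ bit q h →
    transitionBits (bit ∷ oneHot q ++ symBits h) ≡ encodeAction (transition bit q h)
  transitionBits-correct bit q h
    rewrite take-++ (oneHot q) (symBits h) | drop-++ (oneHot q) (symBits h)
          | firstTrue-oneHot q | decodeSym-symBits h = refl

  window-move : ∀ a b mv l w r →
    window a b (move mv (tape l w r)) ≡ apply (shift a b mv) (w ∷ pad (suc a) l ++ pad (suc b) r)
  window-move a b moveL L.[]       w r = trans (cong (λ v → nothing ∷ pad a L.[] ++ v) (pad-∷ b w r))
                                                (sym (shift-++ moveL w (pad (suc a) L.[]) (pad (suc b) r)))
  window-move a b moveL (x L.∷ l)  w r = trans (cong (λ v → x ∷ pad a l ++ v) (pad-∷ b w r))
                                                (sym (shift-++ moveL w (pad (suc a) (x L.∷ l)) (pad (suc b) r)))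
  window-move a b moveR l w L.[]       = trans (cong (λ v → nothing ∷ v ++ pad b L.[]) (pad-∷ a w l))
                                                (sym (shift-++ moveR w (pad (suc a) l) (pad (suc b) L.[])))
  window-move a b moveR l w (x L.∷ r)  = trans (cong (λ v → x ∷ v ++ pad b r) (pad-∷ a w l))
                                                (sym (shift-++ moveR w (pad (suc a) l) (pad (suc b) (x L.∷ r))))
  window-move a b stay  l w r          = trans (cong₂ (λ u v → w ∷ u ++ v) (sym (init-pad a l)) (sym (init-pad b r)))
                                                (sym (shift-++ stay w (pad (suc a) l) (pad (suc b) r)))

  private
    CellCount : ℕ → ℕ → ℕ
    CellCount a b = 1 + (suc a + suc b)

  localInputᴿ : ∀ a b → Rewiring (1 + CodeSize (suc a) (suc b)) (1 + (s + 2))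
  localInputᴿ a b = headᴿ ⊕ᴿ takeᴿ s ∘ᴿ tailᴿ ⊕ᴿ headᴿ ∘ᴿ dropᴿ s ∘ᴿ tailᴿ
                    ⊕ᴿ headᴿ ∘ᴿ dropᴿ (CellCount a b) ∘ᴿ dropᴿ s ∘ᴿ tailᴿ

  -- The rewirings below act on (encoded action ++ path bit ∷ encoded configuration). For the plane of
  -- is-just (true) or of fromMaybe false (false), planeᴿ collects the move bits, the written bit and
  -- the old cells other than the head.
  newStateᴿ : ∀ {n} → Rewiring (s + 4 + n) s
  newStateᴿ = takeᴿ s ∘ᴿ takeᴿ (s + 4)

  private
    writtenᴿ : ∀ {n} → Rewiring (s + 4 + n) 4
    writtenᴿ = dropᴿ s ∘ᴿ takeᴿ (s + 4)

    oldPlanesᴿ : ∀ a b → Rewiring (s + 4 + (1 + CodeSize (suc a) (suc b))) (CellCount a b + CellCount a b)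
    oldPlanesᴿ a b = dropᴿ s ∘ᴿ tailᴿ ∘ᴿ dropᴿ (s + 4)

  planeᴿ : ∀ a b → Bool → Rewiring (s + 4 + (1 + CodeSize (suc a) (suc b))) (2 + CellCount a b)
  planeᴿ a b true  = dropᴿ 2 ∘ᴿ writtenᴿ ⊕ᴿ headᴿ ∘ᴿ writtenᴿ ⊕ᴿ tailᴿ ∘ᴿ takeᴿ (CellCount a b) ∘ᴿ oldPlanesᴿ a b
  planeᴿ a b false = dropᴿ 2 ∘ᴿ writtenᴿ ⊕ᴿ headᴿ ∘ᴿ tailᴿ ∘ᴿ writtenᴿ ⊕ᴿ tailᴿ ∘ᴿ dropᴿ (CellCount a b) ∘ᴿ oldPlanesᴿ a b

  -- The step functions are opaque: conversion checking would otherwise unfold them, at prohibitive cost.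
  opaque
    updateBits : ∀ a b → Vec Bool (s + 4 + (1 + CodeSize (suc a) (suc b))) → Vec Bool (CodeSize a b)
    updateBits a b x =
      apply newStateᴿ x ++ (planeUpdate a b (apply (planeᴿ a b true) x) ++ planeUpdate a b (apply (planeᴿ a b false) x))

  private
    plane-step : ∀ a b mv l w r (f : Sym → Bool) →
      planeUpdate a b (moveBits mv ++ map f (w ∷ pad (suc a) l ++ pad (suc b) r))
      ≡ map f (window a b (move mv (tape l w r)))
    plane-step a b mv l w r f = begin
      planeUpdate a b (moveBits mv ++ map f cells)     ≡⟨ planeUpdate-moveBits mv (map f cells) ⟩
      apply (shift a b mv) (map f cells)               ≡⟨ natural (shift a b mv) f cells ⟩
      map f (apply (shift a b mv) cells)               ≡⟨ cong (map f) (window-move a b mv l w r) ⟨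
      map f (window a b (move mv (tape l w r)))        ∎
      where
      open ≡-Reasoning
      cells = w ∷ pad (suc a) l ++ pad (suc b) r

  opaque
    unfolding updateBits

    updateBits-correct : ∀ a b bit q l h r (X : Fin s × Sym × Move) →
      updateBits a b (encodeAction X ++ (bit ∷ oneHot q ++ planes (h ∷ pad (suc a) l ++ pad (suc b) r)))
      ≡ encodeConfig a b (proj₁ X , move (proj₂ (proj₂ X)) (tape l (proj₁ (proj₂ X)) r))
    updateBits-correct a b bit q l h r (q′ , w , mv) =
      cong₂ _++_ state (cong₂ _++_ (trans (cong (planeUpdate a b) plane-J) (plane-step a b mv l w r is-just))
                                   (trans (cong (planeUpdate a b) plane-V) (plane-step a b mv l w r (fromMaybe false))))
      where
      C : ℕ
      C = CellCount a b
      cells written : Vec Sym C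
      cells = h ∷ pad (suc a) l ++ pad (suc b) r
      written = w ∷ pad (suc a) l ++ pad (suc b) r
      u : Vec Bool (1 + CodeSize (suc a) (suc b))
      u = bit ∷ oneHot q ++ (map is-just cells ++ map (fromMaybe false) cells)
      act : Vec Bool (s + 4)
      act = encodeAction (q′ , w , mv)
      action : take (s + 4) (act ++ u) ≡ act
      action = take-++ act u
      action-tail : drop s act ≡ symBits w ++ moveBits mv
      action-tail = drop-++ (oneHot q′) (symBits w ++ moveBits mv)
      old : drop s (tail (drop (s + 4) (act ++ u))) ≡ map is-just cells ++ map (fromMaybe false) cells
      old = trans (cong (drop s ∘ tail) (drop-++ act u))
                  (drop-++ (oneHot q) (map is-just cells ++ map (fromMaybe false) cells))
      state : apply newStateᴿ (act ++ u) ≡ oneHot q′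
      state = trans (cong (take s) action) (take-++ (oneHot q′) (symBits w ++ moveBits mv))
      plane-J : apply (planeᴿ a b true) (act ++ u) ≡ moveBits mv ++ map is-just written
      plane-J = trans (cong₂ (λ A O → drop 2 (drop s A) ++ (head (drop s A) ∷ []) ++ tail (take C O)) action old)
                      (cong₂ (λ D O → drop 2 D ++ (head D ∷ []) ++ tail O) action-tail
                             (take-++ (map is-just cells) (map (fromMaybe false) cells)))
      plane-V : apply (planeᴿ a b false) (act ++ u) ≡ moveBits mv ++ map (fromMaybe false) written
      plane-V = trans (cong₂ (λ A O → drop 2 (drop s A) ++ (head (tail (drop s A)) ∷ []) ++ tail (drop C O)) action old)
                      (cong₂ (λ D O → drop 2 D ++ (head (tail D) ∷ []) ++ tail O) action-tail
                             (drop-++ (map is-just cells) (map (fromMaybe false) cells)))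

  opaque
    stepBits : ∀ a b → Vec Bool (1 + CodeSize (suc a) (suc b)) → Vec Bool (CodeSize a b)
    stepBits a b u = updateBits a b (transitionBits (apply (localInputᴿ a b) u) ++ u)

  opaque
    unfolding stepBits

    stepBits-correct : ∀ a b bit c →
      stepBits a b (bit ∷ encodeConfig (suc a) (suc b) c) ≡ encodeConfig a b (step M bit c)
    stepBits-correct a b bit (q , tape l h r) =
      trans (cong (λ v → updateBits a b (transitionBits v ++ u)) local-input)
     (trans (cong (λ v → updateBits a b (v ++ u)) (transitionBits-correct bit q h))
     (trans (updateBits-correct a b bit q l h r (transition bit q h))
            (cong (encodeConfig a b) (sym (step-transition bit q l h r)))))
      where
      cells : Vec Sym (CellCount a b)
      cells = h ∷ pad (suc a) l ++ pad (suc b) r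
      u : Vec Bool (1 + CodeSize (suc a) (suc b))
      u = bit ∷ oneHot q ++ planes cells
      local-input : apply (localInputᴿ a b) u ≡ bit ∷ oneHot q ++ symBits h
      local-input rewrite take-++ (oneHot q) (planes cells) | drop-++ (oneHot q) (planes cells)
                        | drop-++ (map is-just cells) (map (fromMaybe false) cells) = refl

  private
    K = tableSize (1 + (s + 2)) (s + 4)

  stepSize : ℕ → ℕ → ℕ
  stepSize a b = ((I + K) + I) + (X + ((X + P) + (X + P)))
    where
    I = 1 + CodeSize (suc a) (suc b)
    X = s + 4 + I
    P = 2 + (1 + (suc a + suc b)) + 50 * suc (1 + (a + b)) * suc (1 + (a + b))

  opaque
    unfolding stepBits updateBits

    stepᶜ : ∀ a b → Computes (stepSize a b) (stepBits a b)
    stepᶜ a b =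
      (rewiring newStateᴿ &ᶜ planeUpdateᶜ a b ∘ᶜ rewiring (planeᴿ a b true) &ᶜ planeUpdateᶜ a b ∘ᶜ rewiring (planeᴿ a b false))
      ∘ᶜ (table (1 + (s + 2)) (s + 4) transitionBits ∘ᶜ rewiring (localInputᴿ a b) &ᶜ rewiring idᴿ)

  stepSize-bound : ∀ a b → stepSize a b ≤ K + 100 * ((a + b + s + 4) * (a + b + s + 4))
  stepSize-bound a b = m+o≡n⇒m≤n (200 * (a + b) * s + 100 * s * s + 792 * s + 388 * (a + b) + 1143) (arith a b s K)
    where
    arith : ∀ a b s K →
      ((1 + (s + (1 + (suc a + suc b) + (1 + (suc a + suc b)))) + K)
        + (1 + (s + (1 + (suc a + suc b) + (1 + (suc a + suc b))))))
      + ((s + 4 + (1 + (s + (1 + (suc a + suc b) + (1 + (suc a + suc b))))))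
        + (((s + 4 + (1 + (s + (1 + (suc a + suc b) + (1 + (suc a + suc b))))))
            + (2 + (1 + (suc a + suc b)) + 50 * suc (1 + (a + b)) * suc (1 + (a + b))))
          + ((s + 4 + (1 + (s + (1 + (suc a + suc b) + (1 + (suc a + suc b))))))
            + (2 + (1 + (suc a + suc b)) + 50 * suc (1 + (a + b)) * suc (1 + (a + b))))))
      + (200 * (a + b) * s + 100 * s * s + 792 * s + 388 * (a + b) + 1143)
      ≡ K + 100 * ((a + b + s + 4) * (a + b + s + 4))
    arith = solve-∀

  runBits : ∀ t a b → Vec Bool (t + CodeSize (t + a) (t + b)) → Vec Bool (CodeSize a b)
  runBits zero    a b = id
  runBits (suc t) a b =
    runBits t a b ∘ λ v → apply (takeᴿ t ∘ᴿ tailᴿ) v ++ stepBits (t + a) (t + b) (apply (headᴿ ⊕ᴿ dropᴿ t ∘ᴿ tailᴿ) v)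

  runBits-correct : ∀ t a b (p : Vec Bool t) c →
    runBits t a b (p ++ encodeConfig (t + a) (t + b) c) ≡ encodeConfig a b (run M p c)
  runBits-correct zero    a b []      c = refl
  runBits-correct (suc t) a b (x ∷ p) c =
    trans (cong₂ (λ u v → runBits t a b (u ++ stepBits (t + a) (t + b) (x ∷ v))) (take-++ p e) (drop-++ p e))
   (trans (cong (runBits t a b ∘ (p ++_)) (stepBits-correct (t + a) (t + b) x c))
          (runBits-correct t a b p (step M x c)))
    where
    e = encodeConfig (suc t + a) (suc t + b) c

  runSize : ℕ → ℕ → ℕ → ℕ
  runSize zero    a b = CodeSize a b
  runSize (suc t) a b = (width + (width + stepSize (t + a) (t + b))) + runSize t a b
    where width = suc t + CodeSize (suc t + a) (suc t + b)

  runᶜ : ∀ t a b → Computes (runSize t a b) (runBits t a b)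
  runᶜ zero    a b = rewiring idᴿ
  runᶜ (suc t) a b =
    runᶜ t a b ∘ᶜ (rewiring (takeᴿ t ∘ᴿ tailᴿ) &ᶜ stepᶜ (t + a) (t + b) ∘ᶜ rewiring (headᴿ ⊕ᴿ dropᴿ t ∘ᴿ tailᴿ))

  runBound : ℕ → ℕ
  runBound z = K + 100 * (z * z) + 5 * z

  runBound-mono : ∀ {z z′} → z ≤ z′ → runBound z ≤ runBound z′
  runBound-mono z≤z′ = +-mono-≤ (+-monoʳ-≤ K (*-monoʳ-≤ 100 (*-mono-≤ z≤z′ z≤z′))) (*-monoʳ-≤ 5 z≤z′)

  runWidth : ℕ → ℕ → ℕ → ℕ
  runWidth t a b = t + t + a + b + s + 4

  runSize-bound : ∀ t a b → runSize t a b ≤ suc t * runBound (runWidth t a b)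
  runSize-bound zero a b = begin
    CodeSize a b                                ≤⟨ m+o≡n⇒m≤n (3 * a + 3 * b + 4 * s + 18) (arith a b s) ⟩
    5 * runWidth 0 a b                          ≤⟨ m≤n+m _ (K + 100 * (runWidth 0 a b * runWidth 0 a b)) ⟩
    runBound (runWidth 0 a b)                   ≡⟨ +-identityʳ _ ⟨
    1 * runBound (runWidth 0 a b)               ∎
    where
    open ≤-Reasoning
    arith : ∀ a b s → s + (1 + (a + b) + (1 + (a + b))) + (3 * a + 3 * b + 4 * s + 18) ≡ 5 * (a + b + s + 4)
    arith = solve-∀
  runSize-bound (suc t) a b = begin
    (width + (width + stepSize (t + a) (t + b))) + runSize t a b
      ≤⟨ +-mono-≤ (+-monoʳ-≤ width (+-monoʳ-≤ width (stepSize-bound (t + a) (t + b))))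
                  (≤-trans (runSize-bound t a b) (*-monoʳ-≤ (suc t) (runBound-mono (m+o≡n⇒m≤n 2 (Z-grows t a b s))))) ⟩
    (width + (width + (K + 100 * (Y * Y)))) + suc t * runBound Z
      ≡⟨ cong (_+ suc t * runBound Z) (+-assoc width width _) ⟨
    ((width + width) + (K + 100 * (Y * Y))) + suc t * runBound Z
      ≤⟨ +-monoˡ-≤ (suc t * runBound Z) (+-mono-≤ (m+o≡n⇒m≤n (a + b + 3 * s + 16) (twice-width t a b s))
                                                  (+-monoʳ-≤ K (*-monoʳ-≤ 100 (*-mono-≤ Y≤Z Y≤Z)))) ⟩
    (5 * Z + (K + 100 * (Z * Z))) + suc t * runBound Z
      ≡⟨ cong (_+ suc t * runBound Z) (+-comm (5 * Z) _) ⟩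
    suc (suc t) * runBound Z ∎
    where
    open ≤-Reasoning
    width = suc t + CodeSize (suc t + a) (suc t + b)
    Y = t + a + (t + b) + s + 4
    Z = runWidth (suc t) a b
    Z-grows : ∀ t a b s → t + t + a + b + s + 4 + 2 ≡ suc t + suc t + a + b + s + 4
    Z-grows = solve-∀
    Y+2≡Z : ∀ t a b s → t + a + (t + b) + s + 4 + 2 ≡ suc t + suc t + a + b + s + 4
    Y+2≡Z = solve-∀
    Y≤Z : Y ≤ Z
    Y≤Z = m+o≡n⇒m≤n 2 (Y+2≡Z t a b s)
    twice-width : ∀ t a b s → (suc t + (s + (1 + (suc t + a + (suc t + b)) + (1 + (suc t + a + (suc t + b))))))
                              + (suc t + (s + (1 + (suc t + a + (suc t + b)) + (1 + (suc t + a + (suc t + b))))))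
                              + (a + b + 3 * s + 16) ≡ 5 * (suc t + suc t + a + b + s + 4)
    twice-width = solve-∀

  initWindow : ∀ a b → List A → Vec (Maybe A) (1 + (a + b))
  initWindow a b L.[]       = nothing ∷ pad a L.[] ++ pad b L.[]
  initWindow a b (x L.∷ xs) = just x ∷ pad a L.[] ++ pad b (L.map just xs)

  initWindow-map : (g : A → B) → ∀ a b xs → map (Maybe.map g) (initWindow a b xs) ≡ initWindow a b (L.map g xs)
  initWindow-map g a b L.[]       =
    cong (nothing ∷_) (trans (VP.map-++ _ (pad a L.[]) (pad b L.[])) (cong₂ _++_ (pad-map g a L.[]) (pad-map g b L.[])))
  initWindow-map g a b (x L.∷ xs) =
    cong (just (g x) ∷_) (trans (VP.map-++ _ (pad a L.[]) (pad b (L.map just xs)))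
      (cong₂ _++_ (pad-map g a L.[])
                  (trans (pad-map g b (L.map just xs)) (cong (pad b) (trans (sym (LP.map-∘ xs)) (LP.map-∘ xs))))))

  window-initTape : ∀ a b xs → window a b (initTape xs) ≡ initWindow a b xs
  window-initTape a b L.[]       = refl
  window-initTape a b (x L.∷ xs) = refl

  initTemplate : ∀ a b → List (Bool ⊎ Fin l) → Vec (Bool ⊎ Fin l) (CodeSize a b)
  initTemplate a b X = map inj₁ (oneHot (NTM.start M)) ++ (map (inj₁ ∘ is-just) cells ++ map (fromMaybe (inj₁ false)) cells)
    where cells = initWindow a b X

  initTemplate-correct : ∀ a b (key : Vec Bool l) X →
    map (instantiate key) (initTemplate a b X) ≡ encodeConfig a b (NTM.start M , initTape (L.map (instantiate key) X))
  initTemplate-correct a b key X = begin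
    map g (map inj₁ (oneHot q₀) ++ (map (inj₁ ∘ is-just) cells ++ map (fromMaybe (inj₁ false)) cells))
      ≡⟨ trans (VP.map-++ g (map inj₁ (oneHot q₀)) _)
               (cong (map g (map inj₁ (oneHot q₀)) ++_) (VP.map-++ g (map (inj₁ ∘ is-just) cells) _)) ⟩
    map g (map inj₁ (oneHot q₀)) ++ (map g (map (inj₁ ∘ is-just) cells) ++ map g (map (fromMaybe (inj₁ false)) cells))
      ≡⟨ cong₂ _++_ (trans (sym (VP.map-∘ g inj₁ (oneHot q₀))) (VP.map-id (oneHot q₀)))
                    (cong₂ _++_ (trans (sym (VP.map-∘ g (inj₁ ∘ is-just) cells))
                                       (trans (VP.map-cong is-just-map cells) (VP.map-∘ is-just (Maybe.map g) cells)))
                                (trans (sym (VP.map-∘ g (fromMaybe (inj₁ false)) cells))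
                                       (trans (VP.map-cong fromMaybe-map cells)
                                              (VP.map-∘ (fromMaybe false) (Maybe.map g) cells)))) ⟩
    oneHot q₀ ++ planes (map (Maybe.map g) cells)
      ≡⟨ cong (λ v → oneHot q₀ ++ planes v) (trans (initWindow-map g a b X) (sym (window-initTape a b (L.map g X)))) ⟩
    encodeConfig a b (q₀ , initTape (L.map g X)) ∎
    where
    open ≡-Reasoning
    q₀ = NTM.start M
    g = instantiate key
    cells = initWindow a b X
    is-just-map : ∀ h → g (inj₁ (is-just h)) ≡ is-just (Maybe.map g h)
    is-just-map (just _) = refl
    is-just-map nothing  = refl
    fromMaybe-map : ∀ h → g (fromMaybe (inj₁ false) h) ≡ fromMaybe false (Maybe.map g h)
    fromMaybe-map (just _) = refl
    fromMaybe-map nothing  = refl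

  private
    acceptᴿ : ∀ m → Rewiring (CodeSize 0 m + m) 1
    acceptᴿ m = lookupᴿ (NTM.accept M) ∘ᴿ takeᴿ s ∘ᴿ takeᴿ (CodeSize 0 m)

    outputᴿ : ∀ m → Rewiring (CodeSize 0 m + m) ((suc m + suc m) + m)
    outputᴿ m = dropᴿ s ∘ᴿ takeᴿ (CodeSize 0 m) ⊕ᴿ dropᴿ (CodeSize 0 m)

  decideBits : ∀ m → Vec Bool (CodeSize 0 m + m) → Vec Bool 1
  decideBits m x = conj (apply (acceptᴿ m) x ++ readsBits m (apply (outputᴿ m) x))

  decideᶜ : ∀ m → Computes (((CodeSize 0 m + m) + ((CodeSize 0 m + m) + readsSize m)) + tableSize 2 1) (decideBits m)
  decideᶜ m = table 2 1 conj ∘ᶜ (rewiring (acceptᴿ m) &ᶜ readsᶜ m ∘ᶜ rewiring (outputᴿ m))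

  decideBits-correct : ∀ m q t (z : Vec Bool m) → let w = window 0 m t in
    decideBits m (encodeConfig 0 m (q , t) ++ z)
    ≡ (lookup (oneHot q) (NTM.accept M) ∧ reads m (map is-just w) (map (fromMaybe false) w) z) ∷ []
  decideBits-correct m q t z = begin
    conj ((lookup (take s (take C x)) acc ∷ []) ++ readsBits m (drop s (take C x) ++ drop C x))
      ≡⟨ cong₂ (λ E Z → conj ((lookup (take s E) acc ∷ []) ++ readsBits m (drop s E ++ Z))) (take-++ e z) (drop-++ e z) ⟩
    conj ((lookup (take s e) acc ∷ []) ++ readsBits m (drop s e ++ z))
      ≡⟨ cong₂ (λ Q P → conj ((lookup Q acc ∷ []) ++ readsBits m (P ++ z))) (take-++ (oneHot q) P) (drop-++ (oneHot q) P) ⟩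
    conj ((lookup (oneHot q) acc ∷ []) ++ readsBits m (P ++ z))
      ≡⟨ cong (λ r → conj (lookup (oneHot q) acc ∷ r))
              (readsBits-correct m (map is-just cells) (map (fromMaybe false) cells) z) ⟩
    (lookup (oneHot q) acc ∧ reads m (map is-just cells) (map (fromMaybe false) cells) z) ∷ [] ∎
    where
    open ≡-Reasoning
    acc = NTM.accept M
    C = CodeSize 0 m
    cells = window 0 m t
    P = planes cells
    e = encodeConfig 0 m (q , t)
    x = e ++ z

-- Nondeterministic circuits and the distinguisher

allBits-complete : ∀ k (v : Vec Bool k) → v ∈ allBits k
allBits-complete zero    []          = here refl
allBits-complete (suc k) (true ∷ v)  = ∈-++⁺ˡ (∈-map⁺ (true ∷_) (allBits-complete k v))
allBits-complete (suc k) (false ∷ v) =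
  ∈-++⁺ʳ (L.map (true ∷_) (allBits k)) (∈-map⁺ (false ∷_) (allBits-complete k v))

accepts⇔witness : (D : Circuit (n + k) 1) (y : Vec Bool n) →
  accepts D y ≡ true ⇔ Σ (Vec Bool k) λ w → head (eval D (y ++ w)) ≡ true
accepts⇔witness {k = k} D y = mk⇔
  (λ acc → let (w , t) = Any.satisfied (any⁻ _ (allBits k) (Equivalence.from T-≡ acc)) in w , Equivalence.to T-≡ t)
  (λ (w , t) → Equivalence.to T-≡ (any⁺ _ (lose (allBits-complete k w) (Equivalence.from T-≡ t))))

run-subst : (M : NTM) {t t′ : ℕ} (e : t ≡ t′) (p : Vec Bool t) (c : Config M) →
  run M (subst (Vec Bool) e p) c ≡ run M p c
run-subst M refl p c = refl

module Distinguisher {N m ℓ : ℕ → ℕ} (G : (n : ℕ) → Circuit n (N n)) (H : (n : ℕ) → Circuit (ℓ n + N n) (m n))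
                     (A : NPAlgorithm) (n : ℕ) where

  private
    M = NPAlgorithm.machine A
    X = HashAfterCode.template (H n) (G n)
  open Simulation M

  C : Vec Bool (ℓ n) → Circuit n (m n)
  C key = hashAfter (H n) key (G n)

  -- A's running time on every C key, whose codes all have the length of the template.
  pathLength : ℕ
  pathLength = timeBound A (L.length X)

  start : Vec Bool (ℓ n) → Config M
  start key = NTM.start M , initTape (L.map (instantiate key) X)

  -- The distinguisher reads y and guesses key and a computation path of A on C key.
  accepts-with : Vec Bool (N n) → Vec Bool (ℓ n) → Vec Bool pathLength → Bool
  accepts-with y key p =
    let (q , t) = run M p (start key) ; cells = window 0 (m n) t in
    lookup (oneHot q) (NTM.accept M) ∧ reads (m n) (map is-just cells) (map (fromMaybe false) cells) (eval (H n) (key ++ y))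

  inputs : ℕ
  inputs = N n + (ℓ n + pathLength)

  private
    yᴿ : Rewiring inputs (N n)
    yᴿ = takeᴿ (N n)

    keyᴿ : Rewiring inputs (ℓ n)
    keyᴿ = takeᴿ (ℓ n) ∘ᴿ dropᴿ (N n)

    pathᴿ : Rewiring inputs pathLength
    pathᴿ = dropᴿ (ℓ n) ∘ᴿ dropᴿ (N n)

    startCode : Vec Bool (ℓ n) → Vec Bool (CodeSize (pathLength + 0) (pathLength + m n))
    startCode key = map (instantiate key) (initTemplate (pathLength + 0) (pathLength + m n) X)

    DBits : Vec Bool inputs → Vec Bool 1
    DBits x = decideBits (m n) (runBits pathLength 0 (m n) (apply pathᴿ x ++ startCode (apply keyᴿ x))
                                ++ eval (H n) (apply (keyᴿ ⊕ᴿ yᴿ) x))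

  DSize : ℕ
  DSize = (((inputs + (inputs + (2 + ℓ n))) + runSize pathLength 0 (m n)) + (inputs + size (H n)))
          + (((CodeSize 0 (m n) + m n) + ((CodeSize 0 (m n) + m n) + readsSize (m n))) + tableSize 2 1)

  private
    Dᶜ : Computes DSize DBits
    Dᶜ = decideᶜ (m n) ∘ᶜ (runᶜ pathLength 0 (m n)
                            ∘ᶜ (rewiring pathᴿ &ᶜ templateᶜ (initTemplate (pathLength + 0) (pathLength + m n) X) ∘ᶜ rewiring keyᴿ)
                         &ᶜ circuitᶜ (H n) ∘ᶜ rewiring (keyᴿ ⊕ᴿ yᴿ))

  -- Opaque: otherwise the type checker may evaluate the whole circuit symbolically.
  opaque
    D : Circuit inputs 1
    D = circ Dᶜ

  opaque
    unfolding D

    size-D : size D ≤ DSize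
    size-D = size-circ Dᶜ

    eval-D : ∀ y key p → eval D (y ++ (key ++ p)) ≡ accepts-with y key p ∷ []
    eval-D y key p =
      trans (eval-circ Dᶜ (y ++ (key ++ p)))
     (trans (cong₂ (λ p′ key′ → decideBits (m n) (runBits pathLength 0 (m n) (p′ ++ startCode key′)
                                                   ++ eval (H n) (key′ ++ apply yᴿ (y ++ (key ++ p)))))
                   (trans (cong (drop (ℓ n)) (drop-++ y (key ++ p))) (drop-++ key p))
                   (trans (cong (take (ℓ n)) (drop-++ y (key ++ p))) (take-++ key p)))
     (trans (cong (λ y′ → decideBits (m n) (runBits pathLength 0 (m n) (p ++ startCode key) ++ eval (H n) (key ++ y′)))
                  (take-++ y (key ++ p)))
     (trans (cong (λ c → decideBits (m n) (runBits pathLength 0 (m n) (p ++ c) ++ eval (H n) (key ++ y)))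
                  (initTemplate-correct (pathLength + 0) (pathLength + m n) key X))
     (trans (cong (λ c → decideBits (m n) (c ++ eval (H n) (key ++ y))) (runBits-correct pathLength 0 (m n) p (start key)))
            (decideBits-correct (m n) (proj₁ (run M p (start key))) (proj₂ (run M p (start key)))
                                (eval (H n) (key ++ y)))))))

  code-C : ∀ key → encode (C key) ≡ L.map (instantiate key) X
  code-C = HashAfterCode.encode-hashAfter (H n) (G n)

  pathLength-code : ∀ key → timeBound A (L.length (encode (C key))) ≡ pathLength
  pathLength-code key = cong (timeBound A) (trans (cong L.length (code-C key)) (LP.length-map _ X))

  Path : Vec Bool (ℓ n) → Set
  Path key = Vec Bool (timeBound A (L.length (encode (C key))))

  toPath : ∀ key → Path key → Vec Bool pathLength
  toPath key = subst (Vec Bool) (pathLength-code key)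

  fromPath : ∀ key → Vec Bool pathLength → Path key
  fromPath key = subst (Vec Bool) (sym (pathLength-code key))

  finalConfig-fromPath : ∀ key p → finalConfig A (encode (C key)) (fromPath key p) ≡ run M p (start key)
  finalConfig-fromPath key p = trans (run-subst M (sym (pathLength-code key)) p _)
                                     (cong (λ x → run M p (NTM.start M , initTape x)) (code-C key))

  finalConfig-toPath : ∀ key p′ → run M (toPath key p′) (start key) ≡ finalConfig A (encode (C key)) p′
  finalConfig-toPath key p′ = trans (run-subst M (pathLength-code key) p′ _)
                                    (cong (λ x → run M p′ (NTM.start M , initTape x)) (sym (code-C key)))

  accepts-with⇒ : ∀ y key p → accepts-with y key p ≡ true →
    AcceptingPath A (encode (C key)) (fromPath key p)
    × (pathOutput A (encode (C key)) (fromPath key p) ≡ V.toList (eval (H n) (key ++ y)))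
  accepts-with⇒ y key p eq =
    trans (cong proj₁ (finalConfig-fromPath key p)) (lookup-oneHot⇒≡ _ _ (proj₁ (∧-true eq))) ,
    trans (cong (readOut ∘ proj₂) (finalConfig-fromPath key p))
          (reads⇒takeBits (m n) (Tape.hd t L.∷ Tape.rgt t) (eval (H n) (key ++ y)) (proj₂ (∧-true eq)))
    where t = proj₂ (run M p (start key))

  ⇒accepts-with : ∀ y key p′ → AcceptingPath A (encode (C key)) p′ →
    pathOutput A (encode (C key)) p′ ≡ V.toList (eval (H n) (key ++ y)) → accepts-with y key (toPath key p′) ≡ true
  ⇒accepts-with y key p′ acc out = cong₂ _∧_
    (trans (cong (λ c → lookup (oneHot (proj₁ c)) (NTM.accept M)) (finalConfig-toPath key p′))
           (trans (cong (λ q → lookup (oneHot q) (NTM.accept M)) acc) (lookup-oneHot (NTM.accept M))))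
    (trans (cong (λ c → reads (m n) (map is-just (cells c)) (map (fromMaybe false) (cells c)) z)
                 (finalConfig-toPath key p′))
           (takeBits⇒reads (m n) _ z out))
    where
    z = eval (H n) (key ++ y)
    cells = λ (c : Config M) → window 0 (m n) (proj₂ c)

  accepts-D⇒ : ∀ y → accepts D y ≡ true →
    Σ (Vec Bool (ℓ n)) λ key → Σ (Vec Bool pathLength) λ p → accepts-with y key p ≡ true
  accepts-D⇒ y acc = take (ℓ n) guess , drop (ℓ n) guess , (begin
    accepts-with y (take (ℓ n) guess) (drop (ℓ n) guess)
      ≡⟨ cong head (eval-D y (take (ℓ n) guess) (drop (ℓ n) guess)) ⟨
    head (eval D (y ++ (take (ℓ n) guess ++ drop (ℓ n) guess)))
      ≡⟨ cong (λ v → head (eval D (y ++ v))) (VP.take++drop≡id (ℓ n) guess) ⟩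
    head (eval D (y ++ guess))
      ≡⟨ proj₂ witness ⟩
    true ∎)
    where
    open ≡-Reasoning
    witness = Equivalence.to (accepts⇔witness {N n} {ℓ n + pathLength} D y) acc
    guess = proj₁ witness

  ⇒accepts-D : ∀ y key p → accepts-with y key p ≡ true → accepts D y ≡ true
  ⇒accepts-D y key p eq =
    Equivalence.from (accepts⇔witness {N n} {ℓ n + pathLength} D y) (key ++ p , trans (cong head (eval-D y key p)) eq)

  rejects-range : (∀ key → SolvesAvoid A (C key)) → ∀ x → accepts D (eval (G n) x) ≡ false
  rejects-range solves x = ¬-not λ acc →
    let (key , p , eq) = accepts-D⇒ (eval (G n) x) acc
        (accepting , output) = accepts-with⇒ (eval (G n) x) key p eq
    in proj₂ (proj₂ (solves key) (fromPath key p) accepting)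
             (x , trans (cong V.toList (eval-hashAfter (H n) key (G n) x)) (sym output))

  -- An output z of A on C key lies outside the range, yet D accepts every y hashing to z.
  solves⇒fibre-accepted : ∀ key → SolvesAvoid A (C key) →
    Σ (Vec Bool (m n)) λ z → ∀ y → eval (H n) (key ++ y) ≡ z → accepts D y ≡ true
  solves⇒fibre-accepted key ((p′ , accepting) , avoids) = z , λ y hy →
    ⇒accepts-D y key (toPath key p′) (⇒accepts-with y key p′ accepting (trans (sym toList-z) (cong V.toList (sym hy))))
    where
    o = pathOutput A (encode (C key)) p′
    z = V.cast (proj₁ (avoids p′ accepting)) (V.fromList o)
    toList-z : V.toList z ≡ o
    toList-z = trans (VP.toList-cast (proj₁ (avoids p′ accepting)) (V.fromList o)) (VP.toList∘fromList o)

𝟙 : Bool → ℕ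
𝟙 b = if b then 1 else 0

∑ : ∀ {A : Set} → List A → (A → ℕ) → ℕ
∑ L.[]       f = 0
∑ (x L.∷ xs) f = f x + ∑ xs f

syntax ∑ xs (λ x → e) = ∑[ x ← xs ] e

count-∑ : (p : A → Bool) (xs : List A) → count p xs ≡ ∑[ x ← xs ] 𝟙 (p x)
count-∑ p L.[]       = refl
count-∑ p (x L.∷ xs) = cong (𝟙 (p x) +_) (count-∑ p xs)

∑-cong : ∀ {f g : A → ℕ} → f ≗ g → ∀ xs → ∑ xs f ≡ ∑ xs g
∑-cong f≗g L.[]       = refl
∑-cong f≗g (x L.∷ xs) = cong₂ _+_ (f≗g x) (∑-cong f≗g xs)

∑-mono : ∀ {f g : A → ℕ} → (∀ x → f x ≤ g x) → ∀ xs → ∑ xs f ≤ ∑ xs g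
∑-mono f≤g L.[]       = z≤n
∑-mono f≤g (x L.∷ xs) = +-mono-≤ (f≤g x) (∑-mono f≤g xs)

∑-+ : ∀ (f g : A → ℕ) xs → ∑[ x ← xs ] (f x + g x) ≡ ∑ xs f + ∑ xs g
∑-+ f g L.[]       = refl
∑-+ f g (x L.∷ xs) = trans (cong (f x + g x +_) (∑-+ f g xs)) (+-+-comm (f x) (g x) (∑ xs f) (∑ xs g))
  where +-+-comm : ∀ a b c d → a + b + (c + d) ≡ a + c + (b + d)
        +-+-comm = solve-∀

∑-*ˡ : ∀ c (f : A → ℕ) xs → ∑[ x ← xs ] (c * f x) ≡ c * ∑ xs f
∑-*ˡ c f L.[]       = sym (*-zeroʳ c)
∑-*ˡ c f (x L.∷ xs) = trans (cong (c * f x +_) (∑-*ˡ c f xs)) (sym (*-distribˡ-+ c (f x) (∑ xs f)))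

∑-*ʳ : ∀ c (f : A → ℕ) xs → ∑[ x ← xs ] (f x * c) ≡ ∑ xs f * c
∑-*ʳ c f xs = trans (∑-cong (λ x → *-comm (f x) c) xs) (trans (∑-*ˡ c f xs) (*-comm c (∑ xs f)))

∑-const : ∀ c (xs : List A) → ∑[ x ← xs ] c ≡ c * L.length xs
∑-const c L.[]       = sym (*-zeroʳ c)
∑-const c (x L.∷ xs) = trans (cong (c +_) (∑-const c xs)) (sym (*-suc c (L.length xs)))

∑-++ : ∀ (f : A → ℕ) xs ys → ∑ (xs L.++ ys) f ≡ ∑ xs f + ∑ ys f
∑-++ f L.[]       ys = refl
∑-++ f (x L.∷ xs) ys = trans (cong (f x +_) (∑-++ f xs ys)) (sym (+-assoc (f x) _ _))

∑-map : ∀ (f : B → ℕ) (g : A → B) xs → ∑ (L.map g xs) f ≡ ∑[ x ← xs ] f (g x)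
∑-map f g L.[]       = refl
∑-map f g (x L.∷ xs) = cong (f (g x) +_) (∑-map f g xs)

∑-swap : ∀ (f : A → B → ℕ) xs ys → ∑[ x ← xs ] ∑[ y ← ys ] f x y ≡ ∑[ y ← ys ] ∑[ x ← xs ] f x y
∑-swap f L.[]       ys = sym (∑-const 0 ys)
∑-swap f (x L.∷ xs) ys =
  trans (cong (∑[ y ← ys ] f x y +_) (∑-swap f xs ys)) (sym (∑-+ (f x) (λ y → ∑[ x ← xs ] f x y) ys))

∑-positive : ∀ (f : A → ℕ) xs → 0 < ∑ xs f → Σ A λ x → 0 < f x
∑-positive f (x L.∷ xs) pos with f x in eq
... | zero  = ∑-positive f xs pos
... | suc _ = x , subst (0 <_) (sym eq) z<s

∑<length : ∀ (f : A → ℕ) xs → ∑ xs f < L.length xs → Σ A λ x → f x ≡ 0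
∑<length f (x L.∷ xs) lt with f x in eq
... | zero  = x , eq
... | suc k = ∑<length f xs (≤-trans (s≤s (m≤n+m (∑ xs f) k)) (≤-pred lt))

∑≡0 : ∀ (f : A → ℕ) {x xs} → ∑ xs f ≡ 0 → x ∈ xs → f x ≡ 0
∑≡0 f {xs = y L.∷ xs} eq (here refl) = m+n≡0⇒m≡0 (f y) eq
∑≡0 f {xs = y L.∷ xs} eq (there x∈) = ∑≡0 f (m+n≡0⇒n≡0 (f y) eq) x∈

∑-* : ∀ (f : A → ℕ) (g : B → ℕ) xs ys → ∑ xs f * ∑ ys g ≡ ∑[ x ← xs ] ∑[ y ← ys ] (f x * g y)
∑-* f g L.[]       ys = refl
∑-* f g (x L.∷ xs) ys =
  trans (*-distribʳ-+ (∑ ys g) (f x) (∑ xs f)) (cong₂ _+_ (sym (∑-*ˡ (f x) g ys)) (∑-* f g xs ys))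

length-allBits : ∀ k → L.length (allBits k) ≡ 2 ^ k
length-allBits zero    = refl
length-allBits (suc k) = begin
  L.length (L.map (true ∷_) (allBits k) L.++ L.map (false ∷_) (allBits k))
    ≡⟨ LP.length-++ (L.map (true ∷_) (allBits k)) ⟩
  L.length (L.map (true ∷_) (allBits k)) + L.length (L.map (false ∷_) (allBits k))
    ≡⟨ cong₂ _+_ (LP.length-map (true ∷_) (allBits k)) (LP.length-map (false ∷_) (allBits k)) ⟩
  L.length (allBits k) + L.length (allBits k)
    ≡⟨ cong (λ x → x + x) (length-allBits k) ⟩
  2 ^ k + 2 ^ k
    ≡⟨ cong (2 ^ k +_) (+-identityʳ (2 ^ k)) ⟨
  2 ^ suc k ∎
  where open ≡-Reasoning

==v⇒≡ : (u v : Vec Bool k) → u ==v v ≡ true → u ≡ v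
==v⇒≡ u v eq with VP.≡-dec Data.Bool._≟_ u v
... | yes u≡v = u≡v

∑-==v : ∀ k (v : Vec Bool k) (f : Vec Bool k → ℕ) → ∑[ u ← allBits k ] (𝟙 (v ==v u) * f u) ≡ f v
∑-==v zero    []      f = trans (+-identityʳ _) (+-identityʳ (f []))
∑-==v (suc k) (true ∷ v) f = begin
  ∑ (L.map (true ∷_) (allBits k) L.++ L.map (false ∷_) (allBits k)) g
    ≡⟨ ∑-++ g (L.map (true ∷_) (allBits k)) _ ⟩
  ∑ (L.map (true ∷_) (allBits k)) g + ∑ (L.map (false ∷_) (allBits k)) g
    ≡⟨ cong₂ _+_ (trans (∑-map g (true ∷_) (allBits k)) (∑-==v k v (f ∘ (true ∷_))))
                 (trans (∑-map g (false ∷_) (allBits k)) (∑-const 0 (allBits k))) ⟩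
  f (true ∷ v) + 0
    ≡⟨ +-identityʳ _ ⟩
  f (true ∷ v) ∎
  where
  open ≡-Reasoning
  g = λ u → 𝟙 ((true ∷ v) ==v u) * f u
∑-==v (suc k) (false ∷ v) f = begin
  ∑ (L.map (true ∷_) (allBits k) L.++ L.map (false ∷_) (allBits k)) g
    ≡⟨ ∑-++ g (L.map (true ∷_) (allBits k)) _ ⟩
  ∑ (L.map (true ∷_) (allBits k)) g + ∑ (L.map (false ∷_) (allBits k)) g
    ≡⟨ cong₂ _+_ (trans (∑-map g (true ∷_) (allBits k)) (∑-const 0 (allBits k)))
                 (trans (∑-map g (false ∷_) (allBits k)) (∑-==v k v (f ∘ (false ∷_)))) ⟩
  f (false ∷ v) ∎
  where
  open ≡-Reasoning
  g = λ u → 𝟙 ((false ∷ v) ==v u) * f u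

𝟙-∧ : ∀ x y → 𝟙 (x ∧ y) ≡ 𝟙 x * 𝟙 y
𝟙-∧ true  y = sym (+-identityʳ (𝟙 y))
𝟙-∧ false y = refl

𝟙*𝟙-positive : ∀ x y → 0 < 𝟙 x * 𝟙 y → (x ≡ true) × (y ≡ true)
𝟙*𝟙-positive true true _ = refl , refl

𝟙-≡ᵇ0 : ∀ c → 𝟙 (c ≡ᵇ 0) ≡ 0 → 0 < c
𝟙-≡ᵇ0 (suc c) _ = z<s

𝟙-idem : ∀ x → 𝟙 x * 𝟙 x ≡ 𝟙 x
𝟙-idem true  = refl
𝟙-idem false = refl

count+∑not : ∀ {A : Set} (p : A → Bool) xs → count p xs + ∑[ x ← xs ] 𝟙 (not (p x)) ≡ L.length xs
count+∑not p L.[]       = refl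
count+∑not p (x L.∷ xs) with p x
... | true  = cong suc (count+∑not p xs)
... | false = trans (+-suc _ _) (cong suc (count+∑not p xs))

-- Pairwise independent hashing covers large sets

2xy≤x²+y² : ∀ x y → 2 * x * y ≤ x * x + y * y
2xy≤x²+y² x y with ≤-total x y
... | inj₁ x≤y = let (d , x+d≡y) = m≤n⇒∃[o]m+o≡n x≤y in
  subst (λ y → 2 * x * y ≤ x * x + y * y) x+d≡y (m+o≡n⇒m≤n (d * d) (square x d))
  where square : ∀ x d → 2 * x * (x + d) + d * d ≡ x * x + (x + d) * (x + d)
        square = solve-∀
... | inj₂ y≤x = let (d , y+d≡x) = m≤n⇒∃[o]m+o≡n y≤x in
  subst (λ x → 2 * x * y ≤ x * x + y * y) y+d≡x (m+o≡n⇒m≤n (d * d) (square y d))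
  where square : ∀ y d → 2 * (y + d) * y + d * d ≡ (y + d) * (y + d) + y * y
        square = solve-∀

flipHead : 0 < k → Vec Bool k → Vec Bool k
flipHead {suc k} _ (b ∷ v) = not b ∷ v

≢-flipHead : (pos : 0 < k) (v : Vec Bool k) → v ≢ flipHead pos v
≢-flipHead {suc k} _ (true ∷ v)  ()
≢-flipHead {suc k} _ (false ∷ v) ()

chebyshev-pointwise : ∀ t M c → t * t * 𝟙 (c ≡ᵇ 0) + 2 * t * (M * c) ≤ M * c * (M * c) + t * t
chebyshev-pointwise t M zero    = ≤-reflexive (eq t M)
  where eq : ∀ t M → t * t * 1 + 2 * t * (M * 0) ≡ M * 0 * (M * 0) + t * t
        eq = solve-∀
chebyshev-pointwise t M (suc c) = begin
  t * t * 0 + 2 * t * x     ≡⟨ cong (_+ 2 * t * x) (*-zeroʳ (t * t)) ⟩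
  2 * t * x                 ≤⟨ 2xy≤x²+y² t x ⟩
  t * t + x * x             ≡⟨ +-comm (t * t) (x * x) ⟩
  x * x + t * t             ∎
  where
  open ≤-Reasoning
  x = M * suc c

-- The arithmetic of Chebyshev's inequality: from the pointwise bound summed over keys and the first and
-- second moments of the fibre size, t B + K ≤ M K.
chebyshev-arith : ∀ t B K M S Q → 0 < t →
  t * t * B + 2 * t * (M * S) ≤ M * M * Q + t * t * K →
  S * M ≡ t * K → Q * (M * M) + t * K ≡ t * t * K + t * M * K →
  t * B + K ≤ M * K
chebyshev-arith t B K M S Q t>0 summed first second = *-cancelʳ-≤ (t * B + K) (M * K) t {{>-nonZero t>0}} (begin
  (t * B + K) * t           ≡⟨ e₁ t B K ⟩
  t * t * B + t * K         ≤⟨ +-cancelʳ-≤ (2 * (t * t * K)) _ _ doubled ⟩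
  t * M * K                 ≡⟨ e₂ t M K ⟩
  M * K * t                 ∎)
  where
  open ≤-Reasoning
  e₁ : ∀ t B K → (t * B + K) * t ≡ t * t * B + t * K
  e₁ = solve-∀
  e₂ : ∀ t M K → t * M * K ≡ M * K * t
  e₂ = solve-∀
  e₃ : ∀ t B K → t * t * B + t * K + 2 * (t * t * K) ≡ t * t * B + 2 * t * (t * K) + t * K
  e₃ = solve-∀
  e₄ : ∀ M Q t K → M * M * Q + t * t * K + t * K ≡ Q * (M * M) + t * K + t * t * K
  e₄ = solve-∀
  e₅ : ∀ t M K → t * t * K + t * M * K + t * t * K ≡ t * M * K + 2 * (t * t * K)
  e₅ = solve-∀
  doubled : t * t * B + t * K + 2 * (t * t * K) ≤ t * M * K + 2 * (t * t * K)
  doubled = begin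
    t * t * B + t * K + 2 * (t * t * K)      ≡⟨ e₃ t B K ⟩
    t * t * B + 2 * t * (t * K) + t * K      ≡⟨ cong (λ u → t * t * B + 2 * t * u + t * K) (trans (*-comm M S) first) ⟨
    t * t * B + 2 * t * (M * S) + t * K      ≤⟨ +-monoˡ-≤ (t * K) summed ⟩
    M * M * Q + t * t * K + t * K            ≡⟨ e₄ M Q t K ⟩
    Q * (M * M) + t * K + t * t * K          ≡⟨ cong (_+ t * t * K) second ⟩
    t * t * K + t * M * K + t * t * K        ≡⟨ e₅ t M K ⟩
    t * M * K + 2 * (t * t * K)              ∎

-- With t = ∣S∣, M = 2 ^ m and K keys, Chebyshev's inequality for the size of the fibre over z shows that
-- the number B of keys missing z satisfies t B + K ≤ M K. Summed over all z this is below K once t ≥ M²,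
-- so some key maps S onto every value.
module Covering {l N m : ℕ} (h : Vec Bool l → Vec Bool N → Vec Bool m)
  (pairwise : ∀ (y y′ : Vec Bool N) → y ≢ y′ → ∀ (a b : Vec Bool m) →
     count (λ key → (h key y ==v a) ∧ (h key y′ ==v b)) (allBits l) * 2 ^ (m + m) ≡ 2 ^ l)
  (S : Vec Bool N → Bool) where

  private
    keys = allBits l
    points = allBits N
    values = allBits m
    K = 2 ^ l
    M = 2 ^ m

    hit : Vec Bool l → Vec Bool N → Vec Bool m → ℕ
    hit key y z = 𝟙 (h key y ==v z)

    pairs : ∀ y y′ → y ≢ y′ → ∀ a b → ∑[ key ← keys ] (hit key y a * hit key y′ b) * (M * M) ≡ K
    pairs y y′ y≢y′ a b = begin
      ∑[ key ← keys ] (hit key y a * hit key y′ b) * (M * M)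
        ≡⟨ cong₂ _*_ (∑-cong (λ key → sym (𝟙-∧ (h key y ==v a) (h key y′ ==v b))) keys)
                     (sym (^-distribˡ-+-* 2 m m)) ⟩
      ∑[ key ← keys ] 𝟙 ((h key y ==v a) ∧ (h key y′ ==v b)) * 2 ^ (m + m)
        ≡⟨ cong (_* 2 ^ (m + m)) (count-∑ _ keys) ⟨
      count (λ key → (h key y ==v a) ∧ (h key y′ ==v b)) keys * 2 ^ (m + m)
        ≡⟨ pairwise y y′ y≢y′ a b ⟩
      K ∎
      where open ≡-Reasoning

    -- Uniformity at a single point, from pairwise independence with any other point.
    single : 0 < N → ∀ y z → ∑[ key ← keys ] hit key y z * M ≡ K
    single pos y z = *-cancelʳ-≡ _ K M {{m^n≢0 2 m}} (begin
      ∑[ key ← keys ] hit key y z * M * M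
        ≡⟨ *-assoc (∑[ key ← keys ] hit key y z) M M ⟩
      ∑[ key ← keys ] hit key y z * (M * M)
        ≡⟨ cong (_* (M * M)) (∑-cong (λ key → sym (∑-==v m (h key y′) (λ _ → hit key y z))) keys) ⟩
      ∑[ key ← keys ] ∑[ b ← values ] (hit key y′ b * hit key y z) * (M * M)
        ≡⟨ cong (_* (M * M)) (∑-swap (λ key b → hit key y′ b * hit key y z) keys values) ⟩
      ∑[ b ← values ] ∑[ key ← keys ] (hit key y′ b * hit key y z) * (M * M)
        ≡⟨ ∑-*ʳ (M * M) _ values ⟨
      ∑[ b ← values ] (∑[ key ← keys ] (hit key y′ b * hit key y z) * (M * M))
        ≡⟨ ∑-cong (λ b → trans (cong (_* (M * M)) (∑-cong (λ key → *-comm (hit key y′ b) _) keys))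
                                (pairs y y′ (≢-flipHead pos y) z b)) values ⟩
      ∑[ b ← values ] K
        ≡⟨ trans (∑-const K values) (cong (K *_) (length-allBits m)) ⟩
      K * M ∎)
      where
      open ≡-Reasoning
      y′ = flipHead pos y

  ∣S∣ : ℕ
  ∣S∣ = ∑[ y ← points ] 𝟙 (S y)

  fibre : Vec Bool m → Vec Bool l → ℕ
  fibre z key = ∑[ y ← points ] (𝟙 (S y) * hit key y z)

  empty : Vec Bool m → ℕ
  empty z = ∑[ key ← keys ] 𝟙 (fibre z key ≡ᵇ 0)

  module _ (pos : 0 < N) (z : Vec Bool m) where

    first-moment : ∑ keys (fibre z) * M ≡ ∣S∣ * K
    first-moment = begin
      ∑ keys (fibre z) * M
        ≡⟨ cong (_* M) (∑-swap (λ key y → 𝟙 (S y) * hit key y z) keys points) ⟩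
      ∑[ y ← points ] ∑[ key ← keys ] (𝟙 (S y) * hit key y z) * M
        ≡⟨ cong (_* M) (∑-cong (λ y → ∑-*ˡ (𝟙 (S y)) (λ key → hit key y z) keys) points) ⟩
      ∑[ y ← points ] (𝟙 (S y) * ∑[ key ← keys ] hit key y z) * M
        ≡⟨ ∑-*ʳ M _ points ⟨
      ∑[ y ← points ] (𝟙 (S y) * ∑[ key ← keys ] hit key y z * M)
        ≡⟨ ∑-cong (λ y → trans (*-assoc (𝟙 (S y)) _ M) (cong (𝟙 (S y) *_) (single pos y z))) points ⟩
      ∑[ y ← points ] (𝟙 (S y) * K)
        ≡⟨ ∑-*ʳ K _ points ⟩
      ∣S∣ * K ∎
      where open ≡-Reasoning

    private
      both : Vec Bool N → Vec Bool N → ℕ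
      both y y′ = 𝟙 (S y) * 𝟙 (S y′)

      collisions : Vec Bool N → Vec Bool N → ℕ
      collisions y y′ = ∑[ key ← keys ] (hit key y z * hit key y′ z)

      ∑-both : ∀ X → ∑[ y ← points ] ∑[ y′ ← points ] (both y y′ * X) ≡ ∣S∣ * ∣S∣ * X
      ∑-both X = begin
        ∑[ y ← points ] ∑[ y′ ← points ] (both y y′ * X)
          ≡⟨ ∑-cong (λ y → trans (∑-cong (λ y′ → *-assoc (𝟙 (S y)) (𝟙 (S y′)) X) points)
                                  (∑-*ˡ (𝟙 (S y)) _ points)) points ⟩
        ∑[ y ← points ] (𝟙 (S y) * ∑[ y′ ← points ] (𝟙 (S y′) * X))
          ≡⟨ ∑-cong (λ y → cong (𝟙 (S y) *_) (∑-*ʳ X _ points)) points ⟩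
        ∑[ y ← points ] (𝟙 (S y) * (∣S∣ * X))
          ≡⟨ ∑-*ʳ (∣S∣ * X) _ points ⟩
        ∣S∣ * (∣S∣ * X)
          ≡⟨ *-assoc ∣S∣ ∣S∣ X ⟨
        ∣S∣ * ∣S∣ * X ∎
        where open ≡-Reasoning

      ∑-both-diagonal : ∀ X →
        ∑[ y ← points ] ∑[ y′ ← points ] (both y y′ * (𝟙 (y ==v y′) * X)) ≡ ∣S∣ * X
      ∑-both-diagonal X = begin
        ∑[ y ← points ] ∑[ y′ ← points ] (both y y′ * (𝟙 (y ==v y′) * X))
          ≡⟨ ∑-cong (λ y → ∑-cong (λ y′ → swap (𝟙 (S y)) (𝟙 (S y′)) (𝟙 (y ==v y′)) X) points) points ⟩
        ∑[ y ← points ] ∑[ y′ ← points ] (𝟙 (y ==v y′) * (both y y′ * X))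
          ≡⟨ ∑-cong (λ y → ∑-==v N y (λ y′ → both y y′ * X)) points ⟩
        ∑[ y ← points ] (both y y * X)
          ≡⟨ ∑-cong (λ y → cong (_* X) (𝟙-idem (S y))) points ⟩
        ∑[ y ← points ] (𝟙 (S y) * X)
          ≡⟨ ∑-*ʳ X _ points ⟩
        ∣S∣ * X ∎
        where
        open ≡-Reasoning
        swap : ∀ a b d X → a * b * (d * X) ≡ d * (a * b * X)
        swap = solve-∀

      collisions-scaled : ∀ y y′ →
        collisions y y′ * (M * M) + 𝟙 (y ==v y′) * K ≡ K + 𝟙 (y ==v y′) * (M * K)
      collisions-scaled y y′ with VP.≡-dec Data.Bool._≟_ y y′
      ... | no y≢y′ = trans (+-identityʳ _) (trans (pairs y y′ y≢y′ z z) (sym (+-identityʳ K)))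
      ... | yes refl = begin
        collisions y y * (M * M) + 1 * K
          ≡⟨ cong (λ c → c * (M * M) + 1 * K) (∑-cong (λ key → 𝟙-idem (h key y ==v z)) keys) ⟩
        ∑[ key ← keys ] hit key y z * (M * M) + 1 * K
          ≡⟨ cong (_+ 1 * K) (*-assoc (∑[ key ← keys ] hit key y z) M M) ⟨
        ∑[ key ← keys ] hit key y z * M * M + 1 * K
          ≡⟨ cong (λ c → c * M + 1 * K) (single pos y z) ⟩
        K * M + 1 * K
          ≡⟨ rearrange K M ⟩
        K + 1 * (M * K) ∎
        where
        open ≡-Reasoning
        rearrange : ∀ K M → K * M + 1 * K ≡ K + 1 * (M * K)
        rearrange = solve-∀

      fibre²-expand : ∑[ key ← keys ] (fibre z key * fibre z key) * (M * M)
                      ≡ ∑[ y ← points ] ∑[ y′ ← points ] (both y y′ * (collisions y y′ * (M * M)))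
      fibre²-expand = begin
        ∑[ key ← keys ] (fibre z key * fibre z key) * (M * M)
          ≡⟨ cong (_* (M * M)) (∑-cong (λ key → ∑-* _ _ points points) keys) ⟩
        ∑[ key ← keys ] ∑[ y ← points ] ∑[ y′ ← points ] (term key y y′) * (M * M)
          ≡⟨ cong (_* (M * M)) (trans (∑-swap _ keys points) (∑-cong (λ y → ∑-swap _ keys points) points)) ⟩
        ∑[ y ← points ] ∑[ y′ ← points ] ∑[ key ← keys ] (term key y y′) * (M * M)
          ≡⟨ cong (_* (M * M)) (∑-cong (λ y → ∑-cong (λ y′ →
               trans (∑-cong (λ key → regroup (𝟙 (S y)) (hit key y z) (𝟙 (S y′)) (hit key y′ z)) keys)
                     (∑-*ˡ (both y y′) _ keys)) points) points) ⟩
        ∑[ y ← points ] ∑[ y′ ← points ] (both y y′ * collisions y y′) * (M * M)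
          ≡⟨ trans (∑-cong (λ y → ∑-*ʳ (M * M) _ points) points) (∑-*ʳ (M * M) _ points) ⟨
        ∑[ y ← points ] ∑[ y′ ← points ] (both y y′ * collisions y y′ * (M * M))
          ≡⟨ ∑-cong (λ y → ∑-cong (λ y′ → *-assoc (both y y′) _ (M * M)) points) points ⟩
        ∑[ y ← points ] ∑[ y′ ← points ] (both y y′ * (collisions y y′ * (M * M))) ∎
        where
        open ≡-Reasoning
        term = λ key y y′ → (𝟙 (S y) * hit key y z) * (𝟙 (S y′) * hit key y′ z)
        regroup : ∀ a b c d → (a * b) * (c * d) ≡ (a * c) * (b * d)
        regroup = solve-∀

    -- Stated with both sides moved so that no subtraction occurs.
    second-moment :
      ∑[ key ← keys ] (fibre z key * fibre z key) * (M * M) + ∣S∣ * K ≡ ∣S∣ * ∣S∣ * K + ∣S∣ * M * K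
    second-moment = begin
      ∑[ key ← keys ] (fibre z key * fibre z key) * (M * M) + ∣S∣ * K
        ≡⟨ cong₂ _+_ fibre²-expand (sym (∑-both-diagonal K)) ⟩
      ∑[ y ← points ] ∑[ y′ ← points ] (both y y′ * (collisions y y′ * (M * M)))
        + ∑[ y ← points ] ∑[ y′ ← points ] (both y y′ * (𝟙 (y ==v y′) * K))
        ≡⟨ split (λ y y′ → collisions y y′ * (M * M)) (λ y y′ → 𝟙 (y ==v y′) * K) ⟨
      ∑[ y ← points ] ∑[ y′ ← points ] (both y y′ * (collisions y y′ * (M * M) + 𝟙 (y ==v y′) * K))
        ≡⟨ ∑-cong (λ y → ∑-cong (λ y′ → cong (both y y′ *_) (collisions-scaled y y′)) points) points ⟩
      ∑[ y ← points ] ∑[ y′ ← points ] (both y y′ * (K + 𝟙 (y ==v y′) * (M * K)))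
        ≡⟨ split (λ _ _ → K) (λ y y′ → 𝟙 (y ==v y′) * (M * K)) ⟩
      ∑[ y ← points ] ∑[ y′ ← points ] (both y y′ * K)
        + ∑[ y ← points ] ∑[ y′ ← points ] (both y y′ * (𝟙 (y ==v y′) * (M * K)))
        ≡⟨ cong₂ _+_ (∑-both K) (trans (∑-both-diagonal (M * K)) (sym (*-assoc ∣S∣ M K))) ⟩
      ∣S∣ * ∣S∣ * K + ∣S∣ * M * K ∎
      where
      open ≡-Reasoning
      split : ∀ (f g : Vec Bool N → Vec Bool N → ℕ) →
        ∑[ y ← points ] ∑[ y′ ← points ] (both y y′ * (f y y′ + g y y′))
        ≡ ∑[ y ← points ] ∑[ y′ ← points ] (both y y′ * f y y′)
          + ∑[ y ← points ] ∑[ y′ ← points ] (both y y′ * g y y′)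
      split f g = trans (∑-cong (λ y → trans (∑-cong (λ y′ → *-distribˡ-+ (both y y′) (f y y′) (g y y′)) points)
                                             (∑-+ _ _ points)) points)
                        (∑-+ _ _ points)

    empty-bound : 0 < ∣S∣ → ∣S∣ * empty z + K ≤ M * K
    empty-bound S>0 = chebyshev-arith ∣S∣ (empty z) K M (∑ keys (fibre z)) Q S>0 summed first-moment second-moment
      where
      open ≡-Reasoning
      t = ∣S∣
      Q = ∑[ key ← keys ] (fibre z key * fibre z key)
      regroup : ∀ M c → M * c * (M * c) ≡ M * M * (c * c)
      regroup = solve-∀
      summed : t * t * empty z + 2 * t * (M * ∑ keys (fibre z)) ≤ M * M * Q + t * t * K
      summed = subst₂ _≤_
        (begin
          ∑[ key ← keys ] (t * t * 𝟙 (fibre z key ≡ᵇ 0) + 2 * t * (M * fibre z key))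
            ≡⟨ ∑-+ _ _ keys ⟩
          ∑[ key ← keys ] (t * t * 𝟙 (fibre z key ≡ᵇ 0)) + ∑[ key ← keys ] (2 * t * (M * fibre z key))
            ≡⟨ cong₂ _+_ (∑-*ˡ (t * t) _ keys) (trans (∑-*ˡ (2 * t) _ keys) (cong (2 * t *_) (∑-*ˡ M _ keys))) ⟩
          t * t * empty z + 2 * t * (M * ∑ keys (fibre z)) ∎)
        (begin
          ∑[ key ← keys ] (M * fibre z key * (M * fibre z key) + t * t)
            ≡⟨ ∑-+ _ _ keys ⟩
          ∑[ key ← keys ] (M * fibre z key * (M * fibre z key)) + ∑[ key ← keys ] (t * t)
            ≡⟨ cong₂ _+_ (trans (∑-cong (λ key → regroup M (fibre z key)) keys) (∑-*ˡ (M * M) _ keys))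
                         (trans (∑-const (t * t) keys) (cong (t * t *_) (length-allBits l))) ⟩
          M * M * Q + t * t * K ∎)
        (∑-mono (λ key → chebyshev-pointwise t M (fibre z key)) keys)

  few-empty : 0 < N → M * M ≤ ∣S∣ → ∑[ z ← values ] empty z < K
  few-empty pos big = ≰⇒> λ K≤E → <⇒≱ KM>0 (+-cancelˡ-≤ (M * M * K) _ _ (begin
    M * M * K + K * M
      ≤⟨ +-monoˡ-≤ (K * M) (*-mono-≤ big K≤E) ⟩
    ∣S∣ * ∑[ z ← values ] empty z + K * M
      ≡⟨ cong₂ _+_ (∑-*ˡ ∣S∣ _ values) (trans (∑-const K values) (cong (K *_) (length-allBits m))) ⟨
    ∑[ z ← values ] (∣S∣ * empty z) + ∑[ z ← values ] K
      ≡⟨ ∑-+ _ _ values ⟨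
    ∑[ z ← values ] (∣S∣ * empty z + K)
      ≤⟨ ∑-mono (λ z → empty-bound pos z S>0) values ⟩
    ∑[ z ← values ] (M * K)
      ≡⟨ trans (∑-const (M * K) values) (cong (M * K *_) (length-allBits m)) ⟩
    M * K * M
      ≡⟨ rearrange M K ⟩
    M * M * K + 0 ∎))
    where
    open ≤-Reasoning
    KM>0 : 0 < K * M
    KM>0 = *-mono-≤ (m^n>0 2 l) (m^n>0 2 m)
    S>0 : 0 < ∣S∣
    S>0 = ≤-trans (*-mono-≤ (m^n>0 2 m) (m^n>0 2 m)) big
    rearrange : ∀ M K → M * K * M ≡ M * M * K + 0
    rearrange = solve-∀

  surjective-key : 0 < N → M * M ≤ ∣S∣ →
    Σ (Vec Bool l) λ key → ∀ z → Σ (Vec Bool N) λ y → S y ≡ true × h key y ≡ z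
  surjective-key pos big = key , preimage
    where
    emptyAt : Vec Bool l → ℕ
    emptyAt key = ∑[ z ← values ] 𝟙 (fibre z key ≡ᵇ 0)
    found = ∑<length emptyAt keys (begin-strict
      ∑ keys emptyAt            ≡⟨ ∑-swap (λ key z → 𝟙 (fibre z key ≡ᵇ 0)) keys values ⟩
      ∑[ z ← values ] empty z   <⟨ few-empty pos big ⟩
      K                         ≡⟨ length-allBits l ⟨
      L.length keys             ∎)
      where open ≤-Reasoning
    key = proj₁ found
    preimage : ∀ z → Σ (Vec Bool N) λ y → S y ≡ true × h key y ≡ z
    preimage z = y , proj₁ in-S-and-hit , ==v⇒≡ (h key y) z (proj₂ in-S-and-hit)
      where
      nonempty : 0 < fibre z key
      nonempty = 𝟙-≡ᵇ0 (fibre z key) (∑≡0 (λ z → 𝟙 (fibre z key ≡ᵇ 0)) (proj₂ found) (allBits-complete m z))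
      y = proj₁ (∑-positive _ points nonempty)
      in-S-and-hit = 𝟙*𝟙-positive (S y) (h key y ==v z) (proj₂ (∑-positive _ points nonempty))

-- Polynomial size bounds

length-unary : ∀ k → L.length (unary k) ≡ suc k
length-unary zero    = refl
length-unary (suc k) = cong suc (length-unary k)

length-encFin : (i : Fin w) → L.length (encFin i) ≤ w
length-encFin i = ≤-trans (≤-reflexive (length-unary (toℕ i))) (toℕ<n i)

length-encGate : (g : Gate w) → L.length (encGate g) ≤ 2 * w + 3
length-encGate {w} (AND i j) = ≤-trans (≤-reflexive (cong (2 +_) (LP.length-++ (encFin i))))
  (≤-trans (s≤s (s≤s (+-mono-≤ (length-encFin i) (length-encFin j)))) (m+o≡n⇒m≤n 1 (arith w)))
  where arith : ∀ w → 2 + (w + w) + 1 ≡ 2 * w + 3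
        arith = solve-∀
length-encGate {w} (OR i j)  = ≤-trans (≤-reflexive (cong (2 +_) (LP.length-++ (encFin i))))
  (≤-trans (s≤s (s≤s (+-mono-≤ (length-encFin i) (length-encFin j)))) (m+o≡n⇒m≤n 1 (arith w)))
  where arith : ∀ w → 2 + (w + w) + 1 ≡ 2 * w + 3
        arith = solve-∀
length-encGate {w} (NOT i)   = ≤-trans (s≤s (s≤s (length-encFin i))) (m+o≡n⇒m≤n (w + 1) (arith w))
  where arith : ∀ w → 2 + w + (w + 1) ≡ 2 * w + 3
        arith = solve-∀
length-encGate {w} (CONST b) = m+o≡n⇒m≤n (2 * w) (+-comm 3 (2 * w))

length-encGates : (gs : Gates n w) → L.length (encGates gs) ≤ w * (2 * w + 3)
length-encGates input              = z≤n
length-encGates {w = suc w} (gs ▷ g) = begin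
  L.length (encGates gs L.++ encGate g)          ≡⟨ LP.length-++ (encGates gs) ⟩
  L.length (encGates gs) + L.length (encGate g)  ≤⟨ +-mono-≤ (length-encGates gs) (length-encGate g) ⟩
  w * (2 * w + 3) + (2 * w + 3)                  ≤⟨ m+o≡n⇒m≤n (2 * w + 2) (arith w) ⟩
  suc w * (2 * suc w + 3)                        ∎
  where
  open ≤-Reasoning
  arith : ∀ w → w * (2 * w + 3) + (2 * w + 3) + (2 * w + 2) ≡ suc w * (2 * suc w + 3)
  arith = solve-∀

length-encOuts : (v : Vec (Fin w) k) → L.length (L.concat (V.toList (map encFin v))) ≤ k * w
length-encOuts []      = z≤n
length-encOuts (i ∷ v) =
  ≤-trans (≤-reflexive (LP.length-++ (encFin i))) (+-mono-≤ (length-encFin i) (length-encOuts v))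

codeBound : ℕ → ℕ → ℕ → ℕ
codeBound n m w = suc n + (suc m + (suc w + (w * (2 * w + 3) + m * w)))

length-encode : (C : Circuit n b) → L.length (encode C) ≤ codeBound n b (size C)
length-encode {n} {b} C = begin
  L.length (unary n L.++ unary b L.++ unary (wires C) L.++ encGates (gates C) L.++ O)
    ≡⟨ trans (LP.length-++ (unary n)) (cong₂ _+_ (length-unary n) (trans (LP.length-++ (unary b))
         (cong₂ _+_ (length-unary b) (trans (LP.length-++ (unary (wires C))) (cong₂ _+_ (length-unary (wires C))
           (LP.length-++ (encGates (gates C)))))))) ⟩
  suc n + (suc b + (suc (wires C) + (L.length (encGates (gates C)) + L.length O)))
    ≤⟨ +-monoʳ-≤ (suc n) (+-monoʳ-≤ (suc b) (+-monoʳ-≤ (suc (wires C))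
         (+-mono-≤ (length-encGates (gates C)) (length-encOuts (outs C))))) ⟩
  codeBound n b (size C) ∎
  where
  open ≤-Reasoning
  O = L.concat (V.toList (map encFin (outs C)))

-- Polynomial bounds with base 2 + n, so that powers are monotone in the exponent.
Poly : (ℕ → ℕ) → Set
Poly f = Σ ℕ λ c → ∀ n → f n ≤ (2 + n) ^ c

private
  c≤2+n^c : ∀ n c → c ≤ (2 + n) ^ c
  c≤2+n^c n c = ≤-trans (<⇒≤ (m<2^m c)) (^-monoˡ-≤ c (m≤m+n 2 n))
    where m<2^m : ∀ c → c < 2 ^ c
          m<2^m zero    = z<s
          m<2^m (suc c) = +-mono-≤ (m^n>0 2 c) (≤-trans (m<2^m c) (m≤m+n (2 ^ c) 0))

  2x≤2+n*x : ∀ n x → x + x ≤ (2 + n) * x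
  2x≤2+n*x n x = ≤-trans (≤-reflexive (cong (x +_) (sym (+-identityʳ x)))) (*-monoˡ-≤ x (m≤m+n 2 n))

PolyBounded⇒Poly : ∀ {f} → PolyBounded f → Poly f
PolyBounded⇒Poly (c , f≤) = suc c , λ n → ≤-trans (f≤ n)
  (≤-trans (+-mono-≤ (^-monoˡ-≤ c (m≤n+m n 2)) (c≤2+n^c n c)) (2x≤2+n*x n ((2 + n) ^ c)))

Poly⇒PolyBounded : ∀ {f} → Poly f → PolyBounded f
Poly⇒PolyBounded (c , f≤) = d , λ n → ≤-trans (f≤ n) (base n)
  where
  d = c + c + 3 ^ c
  base : ∀ n → (2 + n) ^ c ≤ n ^ d + d
  base zero          =
    ≤-trans (^-monoˡ-≤ c (s≤s (s≤s (z≤n {1})))) (≤-trans (m≤n+m (3 ^ c) (c + c)) (m≤n+m d (0 ^ d)))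
  base (suc zero)    = ≤-trans (m≤n+m (3 ^ c) (c + c)) (m≤n+m d (1 ^ d))
  base (suc (suc k)) = begin
    (4 + k) ^ c                  ≤⟨ ^-monoˡ-≤ c (m+o≡n⇒m≤n (k * k + 3 * k) (square k)) ⟩
    ((2 + k) ^ 2) ^ c            ≡⟨ ^-*-assoc (2 + k) 2 c ⟩
    (2 + k) ^ (2 * c)            ≤⟨ ^-monoʳ-≤ (2 + k) (m+o≡n⇒m≤n (3 ^ c) (cong (λ x → c + x + 3 ^ c) (+-identityʳ c))) ⟩
    (2 + k) ^ d                  ≤⟨ m≤m+n _ d ⟩
    (2 + k) ^ d + d              ∎
    where
    open ≤-Reasoning
    square : ∀ k → 4 + k + (k * k + 3 * k) ≡ (2 + k) * ((2 + k) * 1)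
    square = solve-∀

Poly-mono : ∀ {f g} → (∀ n → f n ≤ g n) → Poly g → Poly f
Poly-mono f≤g (c , g≤) = c , λ n → ≤-trans (f≤g n) (g≤ n)

Poly-const : ∀ k → Poly (λ _ → k)
Poly-const k = k , λ n → c≤2+n^c n k

Poly-id : Poly (λ n → n)
Poly-id = 1 , λ n → ≤-trans (m≤n+m n 2) (≤-reflexive (sym (*-identityʳ (2 + n))))

Poly-+ : ∀ {f g} → Poly f → Poly g → Poly (λ n → f n + g n)
Poly-+ (a , f≤) (b , g≤) = suc (a + b) , λ n →
  ≤-trans (+-mono-≤ (≤-trans (f≤ n) (^-monoʳ-≤ (2 + n) (m≤m+n a b)))
                    (≤-trans (g≤ n) (^-monoʳ-≤ (2 + n) (m≤n+m b a))))
          (2x≤2+n*x n ((2 + n) ^ (a + b)))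

Poly-* : ∀ {f g} → Poly f → Poly g → Poly (λ n → f n * g n)
Poly-* (a , f≤) (b , g≤) = a + b , λ n →
  ≤-trans (*-mono-≤ (f≤ n) (g≤ n)) (≤-reflexive (sym (^-distribˡ-+-* (2 + n) a b)))

Poly-^ : ∀ {f} e → Poly f → Poly (λ n → f n ^ e)
Poly-^ e (a , f≤) = a * e , λ n → ≤-trans (^-monoˡ-≤ e (f≤ n)) (≤-reflexive (^-*-assoc (2 + n) a e))

codeBound-mono : ∀ n m {w w′} → w ≤ w′ → codeBound n m w ≤ codeBound n m w′
codeBound-mono n m w≤w′ = +-monoʳ-≤ (suc n) (+-monoʳ-≤ (suc m)
  (+-mono-≤ (s≤s w≤w′) (+-mono-≤ (*-mono-≤ w≤w′ (+-monoˡ-≤ 3 (*-monoʳ-≤ 2 w≤w′))) (*-monoʳ-≤ m w≤w′))))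

inputs≤wires : Gates n w → n ≤ w
inputs≤wires input    = ≤-refl
inputs≤wires (gs ▷ _) = m≤n⇒m≤1+n (inputs≤wires gs)

timeBound-mono : (A : NPAlgorithm) → ∀ {k k′} → k ≤ k′ → timeBound A k ≤ timeBound A k′
timeBound-mono A k≤k′ = +-monoˡ-≤ (NPAlgorithm.exponent A) (^-monoˡ-≤ (NPAlgorithm.exponent A) k≤k′)

∃-dec : ∀ k {P : Vec Bool k → Set} → (∀ v → Dec (P v)) → Dec (Σ (Vec Bool k) P)
∃-dec k P? = map′ Any.satisfied (λ (v , pv) → lose (allBits-complete k v) pv) (Any.any? P? (allBits k))

∀-dec : ∀ k {P : Vec Bool k → Set} → (∀ v → Dec (P v)) → Dec (∀ v → P v)
∀-dec k P? =
  map′ (λ all v → All.lookup all (allBits-complete k v)) (λ f → All.tabulate (λ {v} _ → f v)) (All.all? P? (allBits k))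

SolvesAvoid-dec : (A : NPAlgorithm) (C : Circuit n b) → Dec (SolvesAvoid A C)
SolvesAvoid-dec {n} {b} A C =
  ∃-dec _ accepting? ×-dec
  ∀-dec _ λ p → accepting? p →-dec ((L.length (pathOutput A (encode C) p) ≟ b) ×-dec ¬? (inRange? _))
  where
  accepting? : ∀ p → Dec (AcceptingPath A (encode C) p)
  accepting? p = proj₁ (finalConfig A (encode C) p) Data.Fin.≟ NTM.accept (NPAlgorithm.machine A)
  inRange? : ∀ y → Dec (InRange C y)
  inRange? y = ∃-dec n λ x → LP.≡-dec Data.Bool._≟_ (V.toList (eval C x)) y

module Theorem {N m ℓ : ℕ → ℕ} (G : (n : ℕ) → Circuit n (N n)) (H : (n : ℕ) → Circuit (ℓ n + N n) (m n))
  (A : NPAlgorithm) (size-G : PolyBounded (λ n → size (G n))) (bounded-ℓ : PolyBounded ℓ)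
  (size-H : PolyBounded (λ n → size (H n)))
  (pairwise : ∀ n (y y′ : Vec Bool (N n)) → ¬ (y ≡ y′) → ∀ (a b : Vec Bool (m n)) →
     count (λ key → (eval (H n) (key ++ y) ==v a) ∧ (eval (H n) (key ++ y′) ==v b)) (allBits (ℓ n)) * 2 ^ (m n + m n)
     ≡ 2 ^ ℓ n)
  (10m<N : ∀ n → 10 * m n < N n) where

  module Dist n = Distinguisher G H A n
  open Simulation (NPAlgorithm.machine A) using (CodeSize; runBound; runWidth; runSize-bound)

  private
    s = NTM.states (NPAlgorithm.machine A)
    e = NPAlgorithm.exponent A
    len = Dist.pathLength

    2m<N : ∀ n → suc (m n + m n) ≤ N n
    2m<N n = ≤-trans (s≤s (m+o≡n⇒m≤n (8 * m n) (arith (m n)))) (10m<N n)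
      where arith : ∀ m → m + m + 8 * m ≡ 10 * m
            arith = solve-∀

  DBound : ℕ → ℕ
  DBound n = (((I + (I + (2 + ℓ n))) + suc (len n) * runBound (runWidth (len n) 0 (m n))) + (I + size (H n)))
             + (((CodeSize 0 (m n) + m n) + ((CodeSize 0 (m n) + m n) + 440 * suc (m n) * suc (m n))) + tableSize 2 1)
    where I = Dist.inputs n

  DSize≤DBound : ∀ n → Dist.DSize n ≤ DBound n
  DSize≤DBound n =
    +-mono-≤ (+-monoˡ-≤ (I + size (H n)) (+-monoʳ-≤ (I + (I + (2 + ℓ n))) (runSize-bound (len n) 0 (m n))))
             (+-monoˡ-≤ (tableSize 2 1) (+-monoʳ-≤ (CodeSize 0 (m n) + m n)
                                          (+-monoʳ-≤ (CodeSize 0 (m n) + m n) (readsSize-bound (m n)))))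
    where I = Dist.inputs n

  private
    key₀ : ∀ n → Vec Bool (ℓ n)
    key₀ n = V.replicate (ℓ n) false

    circuitBound : ℕ → ℕ
    circuitBound n = size (G n) + (ℓ n + N n) + size (H n)

    len≤ : ∀ n → len n ≤ timeBound A (codeBound n (m n) (circuitBound n))
    len≤ n = begin
      len n
        ≡⟨ Dist.pathLength-code n (key₀ n) ⟨
      timeBound A (L.length (encode (Dist.C n (key₀ n))))
        ≤⟨ timeBound-mono A (length-encode (Dist.C n (key₀ n))) ⟩
      timeBound A (codeBound n (m n) (size (Dist.C n (key₀ n))))
        ≤⟨ timeBound-mono A (codeBound-mono n (m n) (size-hashAfter (H n) (key₀ n) (G n))) ⟩
      timeBound A (codeBound n (m n) (circuitBound n)) ∎
      where open ≤-Reasoning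

    poly-H : Poly (λ n → size (H n))
    poly-H = PolyBounded⇒Poly size-H

    poly-ℓ : Poly ℓ
    poly-ℓ = PolyBounded⇒Poly bounded-ℓ

    poly-N : Poly N
    poly-N = Poly-mono (λ n → ≤-trans (m≤n+m (N n) (ℓ n)) (inputs≤wires (gates (H n)))) poly-H

    poly-m : Poly m
    poly-m = Poly-mono (λ n → ≤-trans (≤-trans (m≤m+n (m n) (m n)) (n≤1+n _)) (2m<N n)) poly-N

    poly-circuitBound : Poly circuitBound
    poly-circuitBound = Poly-+ (Poly-+ (PolyBounded⇒Poly size-G) (Poly-+ poly-ℓ poly-N)) poly-H

    poly-codeBound : Poly (λ n → codeBound n (m n) (circuitBound n))
    poly-codeBound =
      Poly-+ (Poly-+ (Poly-const 1) Poly-id)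
        (Poly-+ (Poly-+ (Poly-const 1) poly-m)
          (Poly-+ (Poly-+ (Poly-const 1) poly-circuitBound)
            (Poly-+ (Poly-* poly-circuitBound (Poly-+ (Poly-* (Poly-const 2) poly-circuitBound) (Poly-const 3)))
                    (Poly-* poly-m poly-circuitBound))))

    poly-len : Poly len
    poly-len = Poly-mono len≤ (Poly-+ (Poly-^ e poly-codeBound) (Poly-const e))

    poly-width : Poly (λ n → runWidth (len n) 0 (m n))
    poly-width = Poly-+ (Poly-+ (Poly-+ (Poly-+ (Poly-+ poly-len poly-len) (Poly-const 0)) poly-m) (Poly-const s)) (Poly-const 4)

    poly-runBound : Poly (λ n → runBound (runWidth (len n) 0 (m n)))
    poly-runBound =
      Poly-+ (Poly-+ (Poly-const (tableSize (1 + (s + 2)) (s + 4))) (Poly-* (Poly-const 100) (Poly-* poly-width poly-width)))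
             (Poly-* (Poly-const 5) poly-width)

    poly-inputs : Poly Dist.inputs
    poly-inputs = Poly-+ poly-N (Poly-+ poly-ℓ poly-len)

    poly-code : Poly (λ n → CodeSize 0 (m n))
    poly-code = Poly-+ (Poly-const s) (Poly-+ (Poly-+ (Poly-const 1) poly-m) (Poly-+ (Poly-const 1) poly-m))

    poly-DBound : Poly DBound
    poly-DBound = Poly-+
      (Poly-+ (Poly-+ (Poly-+ poly-inputs (Poly-+ poly-inputs (Poly-+ (Poly-const 2) poly-ℓ)))
                      (Poly-* (Poly-+ (Poly-const 1) poly-len) poly-runBound))
              (Poly-+ poly-inputs poly-H))
      (Poly-+ (Poly-+ (Poly-+ poly-code poly-m)
                      (Poly-+ (Poly-+ poly-code poly-m)
                              (Poly-* (Poly-* (Poly-const 440) (Poly-+ (Poly-const 1) poly-m)) (Poly-+ (Poly-const 1) poly-m))))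
              (Poly-const (tableSize 2 1)))

  poly-D : PolyBounded (λ n → size (Dist.D n))
  poly-D = Poly⇒PolyBounded (Poly-mono (λ n → ≤-trans (Dist.size-D n) (DSize≤DBound n)) poly-DBound)

  module _ (n : ℕ) where
    open Distinguisher G H A n

    rejected : Vec Bool (N n) → Bool
    rejected y = not (accepts D y)

    open Covering (λ key y → eval (H n) (key ++ y)) (pairwise n) rejected using (∣S∣; surjective-key)

    few-rejected : (∀ key → SolvesAvoid A (C key)) → ∣S∣ < 2 ^ (m n + m n)
    few-rejected solves = ≰⇒> λ big →
      let N>0 = ≤-trans z<s (2m<N n)
          (key , onto) = surjective-key N>0 (subst (_≤ ∣S∣) (^-distribˡ-+-* 2 (m n) (m n)) big)
          (z , accepted) = solves⇒fibre-accepted key (solves key)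
          (y , y-rejected , hy) = onto z
      in case trans (cong not (sym (accepted y hy))) y-rejected of λ ()

    dense : (∀ key → SolvesAvoid A (C key)) → 2 ^ N n ≤ 3 * count (accepts D) (allBits (N n))
    dense solves = +-cancelʳ-≤ (2 * 2 ^ N n) _ _ (begin
      2 ^ N n + 2 * 2 ^ N n                    ≡⟨⟩
      3 * 2 ^ N n                              ≡⟨ cong (3 *_) total ⟨
      3 * (accepted + ∣S∣)                     ≡⟨ *-distribˡ-+ 3 accepted ∣S∣ ⟩
      3 * accepted + 3 * ∣S∣                   ≤⟨ +-monoʳ-≤ (3 * accepted) (*-monoʳ-≤ 3 (<⇒≤ (few-rejected solves))) ⟩
      3 * accepted + 3 * 2 ^ (m n + m n)       ≤⟨ +-monoʳ-≤ (3 * accepted) (*-monoˡ-≤ (2 ^ (m n + m n)) (n≤1+n 3)) ⟩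
      3 * accepted + 4 * 2 ^ (m n + m n)       ≡⟨ cong (3 * accepted +_) (*-assoc 2 2 (2 ^ (m n + m n))) ⟩
      3 * accepted + 2 * 2 ^ suc (m n + m n)   ≤⟨ +-monoʳ-≤ (3 * accepted) (*-monoʳ-≤ 2 (^-monoʳ-≤ 2 (2m<N n))) ⟩
      3 * accepted + 2 * 2 ^ N n               ∎)
      where
      open ≤-Reasoning
      accepted = count (accepts D) (allBits (N n))
      total : accepted + ∣S∣ ≡ 2 ^ N n
      total = trans (count+∑not (accepts D) (allBits (N n))) (length-allBits (N n))

    some-key-fails :
      ¬ ((2 ^ N n ≤ 3 * count (accepts D) (allBits (N n))) × (∀ x → accepts D (eval (G n) x) ≡ false)) →
      Σ (Vec Bool (ℓ n)) λ key → FailsAvoid A (C key)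
    some-key-fails not-distinguishing with ∃-dec (ℓ n) (λ key → ¬? (SolvesAvoid-dec A (C key)))
    ... | yes found = found
    ... | no none = contradiction (dense solves , rejects-range solves) not-distinguishing
      where
      solves : ∀ key → SolvesAvoid A (C key)
      solves key = decidable-stable (SolvesAvoid-dec A (C key)) λ fails → none (key , fails)

theorem1p2 : (N m ℓ : ℕ → ℕ) (G : (n : ℕ) → Circuit n (N n))
    (H : (n : ℕ) → Circuit (ℓ n + N n) (m n)) (A : NPAlgorithm) →
    IsDemiBitsGenerator N G →
    IsPairwiseIndependentFamily ℓ N m H →
    (∀ n → 10 * m n < N n) →
    (∀ n → n < m n) →
    Eventually (λ n → Σ (Vec Bool (ℓ n)) (λ key → FailsAvoid A (hashAfter (H n) key (G n))))
theorem1p2 N m ℓ G H A (_ , size-G , demi-bits) (bounded-ℓ , size-H , pairwise) 10m<N _ =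
  proj₁ distinguishes , λ n n₀≤n → some-key-fails n (proj₂ distinguishes n n₀≤n)
  where
  open Theorem G H A size-G bounded-ℓ size-H pairwise 10m<N
  distinguishes = demi-bits (λ n → ℓ n + Dist.pathLength n) Dist.D poly-D
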